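{- Let $k\ge 1$. For every $n_1,n_2\in \mathbb{N}$, \[ \tau_{1,k}(n_1n_2) = \sum_{\substack{d_1\mid n_1 \\ d_2\mid n_2}} f_k(d_1,d_2)\, \tau_{1,k}(n_1/d_1)\,\tau_{1,k}(n_2/d_2), \] where $f_k:\mathbb{N}^2\to\mathbb{C}$ is the multiplicative function of two variables given on prime powers $p^{\nu_1},p^{\nu_2}$ by \[ f_k(p^{\nu_1},p^{\nu_2}) = \begin{cases} 1, & \text{if $\nu_1=\nu_2=0$, or $\nu_1,\nu_2\ge 1$ and $\nu_1+\nu_2=k$},\\ -1, & \text{if $\nu_1,\nu_2\ge 1$ and $\nu_1+\nu_2=k+1$},\\ 0, & \text{otherwise}. \end{cases} \]
   Context: $\tau_{1,k}(n)$ denotes the number of pairs $(a,b)$ of positive integers with $ab^k=n$. A function $f:\mathbb{N}^2\to\mathbb{C}$ is multiplicative if it is not identically zero and $f(m_1n_1,m_2n_2)=f(m_1,m_2)f(n_1,n_2)$ whenever $\gcd(m_1m_2,n_1n_2)=1$; such $f$ satisfies $f(n_1,n_2)=\prod_p f(p^{\nu_p(n_1)},p^{\nu_p(n_2)})$, where $\nu_p(n)$ is the exponent of the prime $p$ in $n$. -}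

module Defs where

open import Data.Nat using (ℕ; zero; suc; _+_; _*_; _^_; _≟_)
open import Data.Nat.Divisibility using (_∣?_)
open import Data.Nat.DivMod using (_/_)
open import Data.Nat.Primality using (prime?)
open import Data.Integer as ℤ using (ℤ; +_; -_)
open import Data.List using (List; map; filter; upTo; length; foldr; cartesianProduct; concatMap)
open import Data.Product using (_×_; _,_; proj₁; proj₂)
open import Relation.Nullary using (does)
open import Data.Bool using (true; false; if_then_else_)

range1 : ℕ → List ℕ
range1 n = map suc (upTo n)

-- τ_{1,k}(n) = #{(a,b) positive integers : a * b^k = n}.
-- Any such pair has 1 ≤ a ≤ n and 1 ≤ b ≤ n (for n ≥ 1), so we enumerate [1..n]².
tau1 : ℕ → ℕ → ℕ
tau1 k n = length (filter (λ ab → (proj₁ ab * proj₂ ab ^ k) ≟ n)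
                          (cartesianProduct (range1 n) (range1 n)))

-- p-adic valuation ν_p(n) (for p ≥ 2, n ≥ 1): number of times p divides n.
-- Computed with fuel; fuel n suffices since n / p < n.
νfuel : ℕ → ℕ → ℕ → ℕ
νfuel zero    p             n = 0
νfuel (suc f) zero          n = 0
νfuel (suc f) (suc zero)    n = 0
νfuel (suc f) (suc (suc q)) zero = 0
νfuel (suc f) (suc (suc q)) (suc m) with does (suc (suc q) ∣? suc m)
... | true  = suc (νfuel f (suc (suc q)) (suc m / suc (suc q)))
... | false = 0

ν : ℕ → ℕ → ℕ
ν p n = νfuel n p n

-- local factor of f_k at a prime: f_k(p^ν₁, p^ν₂)
fLocal : ℕ → ℕ → ℕ → ℤ
fLocal k zero    zero    = + 1
fLocal k zero    (suc _) = + 0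
fLocal k (suc _) zero    = + 0
fLocal k (suc a) (suc b) =
  if does (suc a + suc b ≟ k) then + 1
  else if does (suc a + suc b ≟ suc k) then - (+ 1)
  else + 0

primesUpTo : ℕ → List ℕ
primesUpTo N = filter prime? (upTo (suc N))

-- f_k(d₁,d₂) = ∏_p f_k(p^{ν_p(d₁)}, p^{ν_p(d₂)}) (multiplicative extension);
-- for d₁,d₂ ≥ 1 only primes p ≤ d₁ d₂ can contribute a factor ≠ 1.
fk : ℕ → ℕ → ℕ → ℤ
fk k d₁ d₂ = foldr (λ p acc → fLocal k (ν p d₁) (ν p d₂) ℤ.* acc) (+ 1) (primesUpTo (d₁ * d₂))

sumℤ : List ℤ → ℤ
sumℤ = foldr ℤ._+_ (+ 0)

-- indices i with (suc i) ∣ n, i.e. divisors d = suc i of n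
divIdx : ℕ → List ℕ
divIdx n = filter (λ i → suc i ∣? n) (upTo n)

rhs : ℕ → ℕ → ℕ → ℤ
rhs k n₁ n₂ = sumℤ (concatMap (λ i → map (λ j →
    fk k (suc i) (suc j) ℤ.* + tau1 k (n₁ / suc i) ℤ.* + tau1 k (n₂ / suc j))
  (divIdx n₂)) (divIdx n₁))

-- Since a = n / b ^ k is determined by b, τ_{1,k}(n) counts the b with b ^ k ∣ n; hence it is
-- multiplicative, with τ_{1,k}(p ^ c) = ⌊c / k⌋ + 1. The right-hand side is a two-variable Dirichlet
-- convolution of multiplicative functions, so it factorises over the primes too: writing
-- n₁ = p ^ a m₁ and n₂ = p ^ b m₂ with p ∤ m₁ m₂, both sides split off a factor at p, and induction
-- on n₁ n₂ reduces the theorem to the local identity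
--   ∑_{i ≤ a, j ≤ b} f_k(p ^ i, p ^ j) τ(p ^ (a - i)) τ(p ^ (b - j)) = τ(p ^ (a + b)).
-- For a, b < k every τ factor is 1 and in each column j ≥ 1 the values ±1 of f_k cancel, except
-- for a single 1 in column k - a when that column is present; this leaves 1 + [k ≤ a + b] = τ(p ^ (a + b)).
-- Raising a by k adds 1 to τ(p ^ (a - i)) for i ≤ a and brings in the new indices a < i ≤ a + k with
-- τ = 1, so the sum grows by ∑_j (∑_{i ≤ a + k} f_k(p ^ i, p ^ j)) τ(p ^ (b - j)); the inner sum is
-- 1, -1 or 0 according as j = 0, j = k or otherwise, so the growth is
-- τ(p ^ b) - τ(p ^ (b - k)) = 1, or τ(p ^ b) = 1 when b < k.
module Submission where

module FiniteSums where

  open import Data.Nat as ℕ using (ℕ; zero; suc; _≤_; _<_; z≤n; s≤s)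
  import Data.Nat.Properties as ℕP
  open import Data.Integer as ℤ using (ℤ; 0ℤ; 1ℤ; -_; _+_; _-_; _*_)
  import Data.Integer.Properties as ℤP
  open import Data.List using (List; []; _∷_; map; filter; applyUpTo; upTo; length; concatMap; concat; _++_; cartesianProduct)
  open import Data.List.Properties using (map-applyUpTo; map-++; map-∘)
  open import Data.Product using (_×_; _,_)
  open import Relation.Nullary using (Dec; yes; no; ¬_; _×-dec_; _⊎-dec_)
  open import Data.Sum using (_⊎_)
  open import Relation.Unary using (Decidable)
  open import Relation.Binary.PropositionalEquality
  open import Function using (_∘_; id)
  open import Data.Empty using (⊥-elim)
  open import Defs using (sumℤ)
  open import Algebra.Properties.CommutativeSemigroup ℤP.+-commutativeSemigroup using (interchange)

  open ≡-Reasoning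

  χ : ∀ {ℓ} {P : Set ℓ} → Dec P → ℤ
  χ (yes _) = 1ℤ
  χ (no _)  = 0ℤ

  χ-yes : ∀ {ℓ} {P : Set ℓ} (d : Dec P) → P → χ d ≡ 1ℤ
  χ-yes (yes _) _ = refl
  χ-yes (no ¬p) p = ⊥-elim (¬p p)

  χ-no : ∀ {ℓ} {P : Set ℓ} (d : Dec P) → ¬ P → χ d ≡ 0ℤ
  χ-no (yes p) ¬p = ⊥-elim (¬p p)
  χ-no (no _)  _  = refl

  χ-yes-* : ∀ {ℓ} {P : Set ℓ} (d : Dec P) x → P → χ d * x ≡ x
  χ-yes-* d x p = trans (cong (_* x) (χ-yes d p)) (ℤP.*-identityˡ x)

  *-χ-yes : ∀ {ℓ} {P : Set ℓ} x (d : Dec P) → P → x * χ d ≡ x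
  *-χ-yes x d p = trans (cong (x *_) (χ-yes d p)) (ℤP.*-identityʳ x)

  χ-cong : ∀ {ℓ ℓ′} {P : Set ℓ} {Q : Set ℓ′} (d : Dec P) (e : Dec Q) → (P → Q) → (Q → P) → χ d ≡ χ e
  χ-cong (yes p) e f g = sym (χ-yes e (f p))
  χ-cong (no ¬p) e f g = sym (χ-no e (¬p ∘ g))

  χ-*-cong : ∀ {ℓ} {P : Set ℓ} (d : Dec P) {x y : ℤ} → (P → x ≡ y) → χ d * x ≡ χ d * y
  χ-*-cong (yes p) f = cong (1ℤ *_) (f p)
  χ-*-cong (no _)  _ = refl

  χ-×-dec : ∀ {ℓ ℓ′} {P : Set ℓ} {Q : Set ℓ′} (d : Dec P) (e : Dec Q) → χ (d ×-dec e) ≡ χ d * χ e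
  χ-×-dec (yes _) (yes _) = refl
  χ-×-dec (yes _) (no _)  = refl
  χ-×-dec (no _)  _       = refl

  χ-× : ∀ {ℓ ℓ₁ ℓ₂} {P : Set ℓ} {Q : Set ℓ₁} {R : Set ℓ₂} (d : Dec P) (e : Dec Q) (f : Dec R) →
    (P → Q × R) → (Q × R → P) → χ d ≡ χ e * χ f
  χ-× d e f to from = trans (χ-cong d (e ×-dec f) to from) (χ-×-dec e f)

  χ*χ-cong : ∀ {ℓ₁ ℓ₂ ℓ₃ ℓ₄} {P : Set ℓ₁} {Q : Set ℓ₂} {R : Set ℓ₃} {S : Set ℓ₄}
    (d : Dec P) (e : Dec Q) (f : Dec R) (g : Dec S) → (P × Q → R × S) → (R × S → P × Q) → χ d * χ e ≡ χ f * χ g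
  χ*χ-cong d e f g to from = trans (sym (χ-×-dec d e)) (χ-× (d ×-dec e) f g to from)

  χ*χ-no : ∀ {ℓ ℓ′} {P : Set ℓ} {Q : Set ℓ′} (d : Dec P) (e : Dec Q) → ¬ (P × Q) → χ d * χ e ≡ 0ℤ
  χ*χ-no d e ¬pq = trans (sym (χ-×-dec d e)) (χ-no (d ×-dec e) ¬pq)

  χ-⊎ : ∀ {ℓ ℓ₁ ℓ₂} {P : Set ℓ} {Q : Set ℓ₁} {R : Set ℓ₂} (d : Dec P) (e : Dec Q) (f : Dec R) →
    (P → Q ⊎ R) → (Q ⊎ R → P) → ¬ (Q × R) → χ d ≡ χ e + χ f
  χ-⊎ d e f to from disjoint = trans (χ-cong d (e ⊎-dec f) to from) (χ-⊎-dec e f)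
    where
    χ-⊎-dec : (e : Dec _) (f : Dec _) → χ (e ⊎-dec f) ≡ χ e + χ f
    χ-⊎-dec (yes q) (yes r) = ⊥-elim (disjoint (q , r))
    χ-⊎-dec (yes _) (no _)  = refl
    χ-⊎-dec (no _)  (yes _) = refl
    χ-⊎-dec (no _)  (no _)  = refl

  ∑ : ℕ → (ℕ → ℤ) → ℤ
  ∑ zero    g = 0ℤ
  ∑ (suc N) g = g 0 + ∑ N (g ∘ suc)

  ∑-cong : ∀ N {g h : ℕ → ℤ} → (∀ i → i < N → g i ≡ h i) → ∑ N g ≡ ∑ N h
  ∑-cong zero    _ = refl
  ∑-cong (suc N) e = cong₂ _+_ (e 0 (s≤s z≤n)) (∑-cong N (λ i i<N → e (suc i) (s≤s i<N)))

  ∑-zero : ∀ N {g : ℕ → ℤ} → (∀ i → i < N → g i ≡ 0ℤ) → ∑ N g ≡ 0ℤ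
  ∑-zero zero    _ = refl
  ∑-zero (suc N) e = cong₂ _+_ (e 0 (s≤s z≤n)) (∑-zero N (λ i i<N → e (suc i) (s≤s i<N)))

  ∑-+ : ∀ N (g h : ℕ → ℤ) → ∑ N (λ i → g i + h i) ≡ ∑ N g + ∑ N h
  ∑-+ zero    g h = refl
  ∑-+ (suc N) g h = begin
    (g 0 + h 0) + ∑ N (λ i → g (suc i) + h (suc i)) ≡⟨ cong ((g 0 + h 0) +_) (∑-+ N (g ∘ suc) (h ∘ suc)) ⟩
    (g 0 + h 0) + (∑ N (g ∘ suc) + ∑ N (h ∘ suc))   ≡⟨ interchange (g 0) (h 0) _ _ ⟩
    (g 0 + ∑ N (g ∘ suc)) + (h 0 + ∑ N (h ∘ suc))   ∎

  ∑-neg : ∀ N (g : ℕ → ℤ) → ∑ N (λ i → - g i) ≡ - ∑ N g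
  ∑-neg zero    g = refl
  ∑-neg (suc N) g = trans (cong (- g 0 +_) (∑-neg N (g ∘ suc))) (sym (ℤP.neg-distrib-+ (g 0) _))

  ∑-minus : ∀ N (g h : ℕ → ℤ) → ∑ N (λ i → g i - h i) ≡ ∑ N g - ∑ N h
  ∑-minus N g h = trans (∑-+ N g (-_ ∘ h)) (cong (∑ N g +_) (∑-neg N h))

  ∑-*ˡ : ∀ N (c : ℤ) (g : ℕ → ℤ) → ∑ N (λ i → c * g i) ≡ c * ∑ N g
  ∑-*ˡ zero    c g = sym (ℤP.*-zeroʳ c)
  ∑-*ˡ (suc N) c g = trans (cong (c * g 0 +_) (∑-*ˡ N c (g ∘ suc))) (sym (ℤP.*-distribˡ-+ c (g 0) _))

  ∑-*ʳ : ∀ N (c : ℤ) (g : ℕ → ℤ) → ∑ N (λ i → g i * c) ≡ ∑ N g * c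
  ∑-*ʳ N c g = begin
    ∑ N (λ i → g i * c) ≡⟨ ∑-cong N (λ i _ → ℤP.*-comm (g i) c) ⟩
    ∑ N (λ i → c * g i) ≡⟨ ∑-*ˡ N c g ⟩
    c * ∑ N g           ≡⟨ ℤP.*-comm c (∑ N g) ⟩
    ∑ N g * c           ∎

  ∑-snoc : ∀ N (g : ℕ → ℤ) → ∑ (suc N) g ≡ ∑ N g + g N
  ∑-snoc zero    g = trans (ℤP.+-identityʳ (g 0)) (sym (ℤP.+-identityˡ (g 0)))
  ∑-snoc (suc N) g = trans (cong (g 0 +_) (∑-snoc N (g ∘ suc))) (sym (ℤP.+-assoc (g 0) _ _))

  ∑-extend : ∀ N M (g : ℕ → ℤ) → N ≤ M → (∀ i → N ≤ i → i < M → g i ≡ 0ℤ) → ∑ M g ≡ ∑ N g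
  ∑-extend zero    M       g _         e = ∑-zero M (λ i i<M → e i z≤n i<M)
  ∑-extend (suc N) (suc M) g (s≤s N≤M) e =
    cong (g 0 +_) (∑-extend N M (g ∘ suc) N≤M (λ i N≤i i<M → e (suc i) (s≤s N≤i) (s≤s i<M)))

  ∑-δ : ∀ N c (g : ℕ → ℤ) → c < N → ∑ N (λ i → χ (i ℕ.≟ c) * g i) ≡ g c
  ∑-δ (suc N) zero g _ = begin
    1ℤ * g 0 + ∑ N (λ i → χ (suc i ℕ.≟ 0) * g (suc i))
      ≡⟨ cong₂ _+_ (ℤP.*-identityˡ (g 0)) (∑-zero N (λ i _ → cong (_* g (suc i)) (χ-no (suc i ℕ.≟ 0) λ ()))) ⟩
    g 0 + 0ℤ ≡⟨ ℤP.+-identityʳ (g 0) ⟩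
    g 0      ∎
  ∑-δ (suc N) (suc c) g (s≤s c<N) = begin
    χ (0 ℕ.≟ suc c) * g 0 + ∑ N (λ i → χ (suc i ℕ.≟ suc c) * g (suc i))
      ≡⟨ cong₂ _+_ (cong (_* g 0) (χ-no (0 ℕ.≟ suc c) λ ()))
                   (∑-cong N (λ i _ → cong (_* g (suc i)) (χ-cong (suc i ℕ.≟ suc c) (i ℕ.≟ c) ℕP.suc-injective (cong suc)))) ⟩
    0ℤ + ∑ N (λ i → χ (i ℕ.≟ c) * g (suc i)) ≡⟨ ℤP.+-identityˡ _ ⟩
    ∑ N (λ i → χ (i ℕ.≟ c) * g (suc i))      ≡⟨ ∑-δ N c (g ∘ suc) c<N ⟩
    g (suc c)                                ∎

  ∑-χ-≟ : ∀ N c → c < N → ∑ N (λ i → χ (i ℕ.≟ c)) ≡ 1ℤ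
  ∑-χ-≟ N c c<N = trans (∑-cong N (λ i _ → sym (ℤP.*-identityʳ (χ (i ℕ.≟ c))))) (∑-δ N c (λ _ → 1ℤ) c<N)

  ∑-comm : ∀ N M (g : ℕ → ℕ → ℤ) → ∑ N (λ i → ∑ M (g i)) ≡ ∑ M (λ j → ∑ N (λ i → g i j))
  ∑-comm zero    M g = sym (∑-zero M (λ _ _ → refl))
  ∑-comm (suc N) M g = begin
    ∑ M (g 0) + ∑ N (λ i → ∑ M (g (suc i)))           ≡⟨ cong (∑ M (g 0) +_) (∑-comm N M (g ∘ suc)) ⟩
    ∑ M (g 0) + ∑ M (λ j → ∑ N (λ i → g (suc i) j))  ≡⟨ sym (∑-+ M (g 0) _) ⟩
    ∑ M (λ j → g 0 j + ∑ N (λ i → g (suc i) j))      ∎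

  sumℤ-map-upTo : ∀ N (g : ℕ → ℤ) → sumℤ (map g (upTo N)) ≡ ∑ N g
  sumℤ-map-upTo N g = trans (cong sumℤ (map-applyUpTo id g N)) (applyUpTo-sum N g)
    where
    applyUpTo-sum : ∀ N (g : ℕ → ℤ) → sumℤ (applyUpTo g N) ≡ ∑ N g
    applyUpTo-sum zero    g = refl
    applyUpTo-sum (suc N) g = cong (g 0 +_) (applyUpTo-sum N (g ∘ suc))

  sumℤ-++ : ∀ xs ys → sumℤ (xs ++ ys) ≡ sumℤ xs + sumℤ ys
  sumℤ-++ []       ys = sym (ℤP.+-identityˡ _)
  sumℤ-++ (x ∷ xs) ys = trans (cong (x +_) (sumℤ-++ xs ys)) (sym (ℤP.+-assoc x _ _))

  sumℤ-map-filter : ∀ {A : Set} {P : A → Set} (P? : Decidable P) (g : A → ℤ) xs →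
    sumℤ (map g (filter P? xs)) ≡ sumℤ (map (λ x → χ (P? x) * g x) xs)
  sumℤ-map-filter P? g []       = refl
  sumℤ-map-filter P? g (x ∷ xs) with P? x
  ... | yes _ = cong₂ _+_ (sym (ℤP.*-identityˡ (g x))) (sumℤ-map-filter P? g xs)
  ... | no  _ = trans (sumℤ-map-filter P? g xs) (sym (ℤP.+-identityˡ _))

  length-filter≡sumℤ-χ : ∀ {A : Set} {P : A → Set} (P? : Decidable P) xs →
    ℤ.+ length (filter P? xs) ≡ sumℤ (map (χ ∘ P?) xs)
  length-filter≡sumℤ-χ P? []       = refl
  length-filter≡sumℤ-χ P? (x ∷ xs) with P? x
  ... | yes _ = trans (ℤP.pos-+ 1 _) (cong (1ℤ +_) (length-filter≡sumℤ-χ P? xs))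
  ... | no  _ = trans (length-filter≡sumℤ-χ P? xs) (sym (ℤP.+-identityˡ _))

  sumℤ-concatMap : ∀ {A : Set} (f : A → List ℤ) xs → sumℤ (concatMap f xs) ≡ sumℤ (map (sumℤ ∘ f) xs)
  sumℤ-concatMap f []       = refl
  sumℤ-concatMap f (x ∷ xs) = trans (sumℤ-++ (f x) (concat (map f xs))) (cong (sumℤ (f x) +_) (sumℤ-concatMap f xs))

  sumℤ-cartesianProduct : ∀ {A B : Set} (g : A × B → ℤ) xs ys →
    sumℤ (map g (cartesianProduct xs ys)) ≡ sumℤ (map (λ x → sumℤ (map (λ y → g (x , y)) ys)) xs)
  sumℤ-cartesianProduct g []       ys = refl
  sumℤ-cartesianProduct g (x ∷ xs) ys = begin
    sumℤ (map g (map (x ,_) ys ++ cartesianProduct xs ys))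
      ≡⟨ cong sumℤ (map-++ g (map (x ,_) ys) _) ⟩
    sumℤ (map g (map (x ,_) ys) ++ map g (cartesianProduct xs ys))
      ≡⟨ sumℤ-++ (map g (map (x ,_) ys)) _ ⟩
    sumℤ (map g (map (x ,_) ys)) + sumℤ (map g (cartesianProduct xs ys))
      ≡⟨ cong₂ _+_ (cong sumℤ (sym (map-∘ ys))) (sumℤ-cartesianProduct g xs ys) ⟩
    sumℤ (map (λ y → g (x , y)) ys) + sumℤ (map (λ x → sumℤ (map (λ y → g (x , y)) ys)) xs) ∎


module Valuation where

  open import Data.Nat as ℕ using (ℕ; zero; suc; _+_; _*_; _^_; _≤_; _<_; z≤n; s≤s; NonZero; >-nonZero; >-nonZero⁻¹)
  open import Data.Nat.Properties
  open import Data.Nat.Divisibility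
  open import Data.Nat.DivMod using (_/_; m*n/n≡m; m/n<m)
  open import Data.Nat.Induction using (<-rec)
  open import Data.Nat.Primality using (Prime; prime⇒nonZero; prime⇒nonTrivial; ¬prime[0]; ¬prime[1]; euclidsLemma)
  open import Data.Product using (∃; _×_; _,_; proj₁; proj₂)
  open import Data.Sum using (inj₁; inj₂)
  open import Relation.Nullary using (yes; no; does; ¬_)
  open import Data.Bool using (true; false)
  open import Relation.Nullary.Decidable using (dec-true; dec-false)
  open import Relation.Binary.PropositionalEquality
  open import Data.Empty using (⊥-elim)
  open import Defs using (νfuel; ν)

  open ≡-Reasoning

  ∤⇒>0 : ∀ {d m} → ¬ (d ∣ m) → 0 < m
  ∤⇒>0 {m = zero}  d∤0 = ⊥-elim (d∤0 (divides 0 refl))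
  ∤⇒>0 {m = suc _} _   = s≤s z≤n

  ∤-*-prime : ∀ {p x y} → Prime p → ¬ (p ∣ x) → ¬ (p ∣ y) → ¬ (p ∣ x * y)
  ∤-*-prime {x = x} {y} pp p∤x p∤y p∣xy with euclidsLemma x y pp p∣xy
  ... | inj₁ p∣x = p∤x p∣x
  ... | inj₂ p∣y = p∤y p∣y

  prime⇒≡2+ : ∀ {p} → Prime p → ∃ λ q → p ≡ suc (suc q)
  prime⇒≡2+ {suc (suc q)} _  = q , refl
  prime⇒≡2+ {0}           pp = ⊥-elim (¬prime[0] pp)
  prime⇒≡2+ {1}           pp = ⊥-elim (¬prime[1] pp)

  νfuel-0 : ∀ f p → νfuel f p 0 ≡ 0
  νfuel-0 zero    p             = refl
  νfuel-0 (suc f) zero          = refl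
  νfuel-0 (suc f) (suc zero)    = refl
  νfuel-0 (suc f) (suc (suc q)) = refl

  module _ {q : ℕ} where

    private
      p = suc (suc q)

    νfuel-∤ : ∀ f m → ¬ (p ∣ suc m) → νfuel (suc f) p (suc m) ≡ 0
    νfuel-∤ f m p∤m rewrite dec-false (p ∣? suc m) p∤m = refl

    νfuel-∣ : ∀ f m → p ∣ suc m → νfuel (suc f) p (suc m) ≡ suc (νfuel f p (suc m / p))
    νfuel-∣ f m p∣m rewrite dec-true (p ∣? suc m) p∣m = refl

    -- ν p n runs on fuel n, which after one division step no longer matches the argument
    νfuel-enough : ∀ f g n → n ≤ f → n ≤ g → νfuel f p n ≡ νfuel g p n
    νfuel-enough f g zero _ _ = trans (νfuel-0 f p) (sym (νfuel-0 g p))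
    νfuel-enough (suc f) (suc g) (suc m) (s≤s m≤f) (s≤s m≤g) with does (p ∣? suc m)
    ... | true = cong suc (νfuel-enough f g (suc m / p) (≤-trans quot≤m m≤f) (≤-trans quot≤m m≤g))
      where
      quot≤m : suc m / p ≤ m
      quot≤m = ≤-pred (m/n<m (suc m) p (s≤s (s≤s z≤n)))
    ... | false = refl

  module _ {p : ℕ} (pp : Prime p) where

    private
      instance
        p≢0 : NonZero p
        p≢0 = prime⇒nonZero pp
      q = proj₁ (prime⇒≡2+ pp)
      p≡2+q : p ≡ suc (suc q)
      p≡2+q = proj₂ (prime⇒≡2+ pp)

    ν-∤ : ∀ {n} → ¬ (p ∣ n) → ν p n ≡ 0
    ν-∤ {zero}  p∤0 = ⊥-elim (p∤0 (divides 0 refl))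
    ν-∤ {suc m} p∤n rewrite p≡2+q = νfuel-∤ m m p∤n

    ν-p* : ∀ {n} → 0 < n → ν p (p * n) ≡ suc (ν p n)
    ν-p* {suc m} _ rewrite p≡2+q = begin
      νfuel (suc f) (suc (suc q)) (suc f)          ≡⟨ νfuel-∣ f f (m∣m*n (suc m)) ⟩
      suc (νfuel f (suc (suc q)) (suc f / suc (suc q))) ≡⟨ cong (λ x → suc (νfuel f (suc (suc q)) x)) quot ⟩
      suc (νfuel f (suc (suc q)) (suc m))          ≡⟨ cong suc (νfuel-enough f (suc m) (suc m) m<f ≤-refl) ⟩
      suc (νfuel (suc m) (suc (suc q)) (suc m))    ∎
      where
      f = m + suc q * suc m
      quot : suc f / suc (suc q) ≡ suc m
      quot = trans (cong (_/ suc (suc q)) (*-comm (suc (suc q)) (suc m))) (m*n/n≡m (suc m) (suc (suc q)))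
      m<f : suc m ≤ f
      m<f = ≤-trans (≤-reflexive (+-comm 1 m)) (+-monoʳ-≤ m (s≤s z≤n))

    ν-p^* : ∀ i {E} → 0 < E → ν p (p ^ i * E) ≡ i + ν p E
    ν-p^* zero    {E} _   = cong (ν p) (*-identityˡ E)
    ν-p^* (suc i) {E} E>0 = begin
      ν p (p * p ^ i * E)   ≡⟨ cong (ν p) (*-assoc p (p ^ i) E) ⟩
      ν p (p * (p ^ i * E)) ≡⟨ ν-p* (*-mono-< {0} {_} {0} (m^n>0 p i) E>0) ⟩
      suc (ν p (p ^ i * E)) ≡⟨ cong suc (ν-p^* i E>0) ⟩
      suc (i + ν p E)       ∎

    ν-p^*-∤ : ∀ i {E} → ¬ (p ∣ E) → ν p (p ^ i * E) ≡ i
    ν-p^*-∤ i p∤E = trans (ν-p^* i (∤⇒>0 p∤E)) (trans (cong (i +_) (ν-∤ p∤E)) (+-identityʳ i))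

    p-free-part : ∀ n → 0 < n → ∃ λ E → n ≡ p ^ ν p n * E × ¬ (p ∣ E)
    p-free-part = <-rec (λ n → 0 < n → ∃ λ E → n ≡ p ^ ν p n * E × ¬ (p ∣ E)) go
      where
      go : ∀ n → (∀ {m} → m < n → 0 < m → ∃ λ E → m ≡ p ^ ν p m * E × ¬ (p ∣ E)) →
           0 < n → ∃ λ E → n ≡ p ^ ν p n * E × ¬ (p ∣ E)
      go n rec n>0 with p ∣? n
      ... | no p∤n = n , sym (trans (cong (λ v → p ^ v * n) (ν-∤ p∤n)) (*-identityˡ n)) , p∤n
      ... | yes (divides c refl) = E , c*p≡ , p∤E
        where
        instance
          c≢0 : NonZero c
          c≢0 = m*n≢0⇒m≢0 c {{>-nonZero n>0}}
        IH = rec (m<m*n c p (ℕ.nonTrivial⇒n>1 p {{prime⇒nonTrivial pp}})) (>-nonZero⁻¹ c)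
        E = proj₁ IH
        p∤E = proj₂ (proj₂ IH)
        c*p≡ : c * p ≡ p ^ ν p (c * p) * E
        c*p≡ = begin
          c * p                  ≡⟨ *-comm c p ⟩
          p * c                  ≡⟨ cong (p *_) (proj₁ (proj₂ IH)) ⟩
          p * (p ^ ν p c * E)    ≡⟨ sym (*-assoc p _ E) ⟩
          p ^ suc (ν p c) * E    ≡⟨ cong (λ v → p ^ v * E) (sym (trans (cong (ν p) (*-comm c p)) (ν-p* (>-nonZero⁻¹ c)))) ⟩
          p ^ ν p (c * p) * E    ∎

  ν-*-∤ : ∀ {q} → Prime q → ∀ {c} e → ¬ (q ∣ c) → 0 < e → ν q (c * e) ≡ ν q e
  ν-*-∤ {q} qq {c} = <-rec (λ e → ¬ (q ∣ c) → 0 < e → ν q (c * e) ≡ ν q e) go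
    where
    go : ∀ e → (∀ {e′} → e′ < e → ¬ (q ∣ c) → 0 < e′ → ν q (c * e′) ≡ ν q e′) →
         ¬ (q ∣ c) → 0 < e → ν q (c * e) ≡ ν q e
    go e rec q∤c e>0 with q ∣? e
    ... | no q∤e = trans (ν-∤ qq (∤-*-prime qq q∤c q∤e)) (sym (ν-∤ qq q∤e))
    ... | yes (divides e′ refl) = begin
        ν q (c * (e′ * q)) ≡⟨ cong (ν q) (trans (sym (*-assoc c e′ q)) (*-comm (c * e′) q)) ⟩
        ν q (q * (c * e′)) ≡⟨ ν-p* qq (*-mono-< {0} {c} {0} (∤⇒>0 q∤c) e′>0) ⟩
        suc (ν q (c * e′)) ≡⟨ cong suc (rec e′<e q∤c e′>0) ⟩
        suc (ν q e′)       ≡⟨ sym (ν-p* qq e′>0) ⟩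
        ν q (q * e′)       ≡⟨ cong (ν q) (*-comm q e′) ⟩
        ν q (e′ * q)       ∎
      where
      instance
        e′≢0 : NonZero e′
        e′≢0 = m*n≢0⇒m≢0 e′ {{>-nonZero e>0}}
      e′>0 : 0 < e′
      e′>0 = >-nonZero⁻¹ e′
      e′<e : e′ < e′ * q
      e′<e = m<m*n e′ q (ℕ.nonTrivial⇒n>1 q {{prime⇒nonTrivial qq}})


module PrimePowerDivisibility where

  open import Data.Nat as ℕ using (ℕ; zero; suc; _+_; _*_; _^_; _∸_; _≤_; _<_; NonZero; >-nonZero; >-nonZero⁻¹)
  open import Data.Nat.Properties
  open import Data.Nat.Divisibility
  open import Data.Nat.Coprimality using (Coprime; coprime-divisor)
  open import Data.Nat.Primality using (Prime; prime⇒nonZero; prime⇒nonTrivial; prime⇒irreducible; euclidsLemma)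
  open import Data.Product using (_×_; _,_)
  open import Data.Sum using (inj₁; inj₂)
  open import Relation.Nullary using (¬_)
  open import Relation.Binary.PropositionalEquality
  open import Data.Empty using (⊥-elim)
  open import Defs using (ν)
  open Valuation

  ∤⇒∤-divisor : ∀ {p e m} → ¬ (p ∣ m) → e ∣ m → ¬ (p ∣ e)
  ∤⇒∤-divisor p∤m e∣m p∣e = p∤m (∣-trans p∣e e∣m)

  module _ {p : ℕ} (pp : Prime p) where

    private
      instance
        p≢0 : NonZero p
        p≢0 = prime⇒nonZero pp

    ∤-^ : ∀ {x} k → ¬ (p ∣ x) → ¬ (p ∣ x ^ k)
    ∤-^ zero    _   p∣1 = ℕ.nonTrivial⇒≢1 {{prime⇒nonTrivial pp}} (∣1⇒≡1 p∣1)
    ∤-^ (suc k) p∤x = ∤-*-prime pp p∤x (∤-^ k p∤x)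

    ∤⇒coprime : ∀ {E} → ¬ (p ∣ E) → Coprime E p
    ∤⇒coprime p∤E (d∣E , d∣p) with prime⇒irreducible pp d∣p
    ... | inj₁ d≡1 = d≡1
    ... | inj₂ refl = ⊥-elim (p∤E d∣E)

    ∣p^*⇒∣ : ∀ {E} a M → ¬ (p ∣ E) → E ∣ p ^ a * M → E ∣ M
    ∣p^*⇒∣         zero    M p∤E E∣ = subst (_ ∣_) (*-identityˡ M) E∣
    ∣p^*⇒∣ {E} (suc a) M p∤E E∣ =
      ∣p^*⇒∣ a M p∤E (coprime-divisor (∤⇒coprime p∤E) (subst (E ∣_) (*-assoc p (p ^ a) M) E∣))

    p^v*E∣p^a*m⇒ : ∀ v a {E m} → ¬ (p ∣ E) → ¬ (p ∣ m) → p ^ v * E ∣ p ^ a * m → v ≤ a × E ∣ m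
    p^v*E∣p^a*m⇒ v a {E} {m} p∤E p∤m d@(divides z eq) = v≤a , ∣p^*⇒∣ a m p∤E (∣-trans (n∣m*n (p ^ v)) d)
      where
      p^a*m≢0 : NonZero (p ^ a * m)
      p^a*m≢0 = m*n≢0 (p ^ a) m {{m^n≢0 p a}} {{>-nonZero (∤⇒>0 p∤m)}}
      z>0 : 0 < z
      z>0 = >-nonZero⁻¹ z {{m*n≢0⇒m≢0 z {{subst NonZero eq p^a*m≢0}}}}
      v≤a : v ≤ a
      v≤a = begin
        v                           ≤⟨ m≤m+n v _ ⟩
        v + ν p (E * z)             ≡⟨ sym (ν-p^* pp v (*-mono-< {0} {E} {0} (∤⇒>0 p∤E) z>0)) ⟩
        ν p (p ^ v * (E * z))       ≡⟨ cong (ν p) (sym (trans eq (trans (*-comm z _) (*-assoc (p ^ v) E z)))) ⟩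
        ν p (p ^ a * m)             ≡⟨ ν-p^*-∤ pp a p∤m ⟩
        a                           ∎
        where open ≤-Reasoning

    p^v*E∣p^a*m⇐ : ∀ {v a E m} → v ≤ a → E ∣ m → p ^ v * E ∣ p ^ a * m
    p^v*E∣p^a*m⇐ {v} {a} {E} {m} v≤a E∣m =
      subst (p ^ v * E ∣_) eq (*-pres-∣ (∣-refl {p ^ v}) (∣n⇒∣m*n (p ^ (a ∸ v)) E∣m))
      where
      eq : p ^ v * (p ^ (a ∸ v) * m) ≡ p ^ a * m
      eq = trans (sym (*-assoc (p ^ v) _ m))
                 (cong (_* m) (trans (sym (^-distribˡ-+-* p v (a ∸ v))) (cong (p ^_) (m+[n∸m]≡n v≤a))))

    p^i*E≡p^v*D⇒ : ∀ i v {E D} → ¬ (p ∣ E) → ¬ (p ∣ D) → p ^ i * E ≡ p ^ v * D → i ≡ v × E ≡ D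
    p^i*E≡p^v*D⇒ i v {E} {D} p∤E p∤D eq = i≡v , E≡D
      where
      i≡v : i ≡ v
      i≡v = trans (sym (ν-p^*-∤ pp i p∤E)) (trans (cong (ν p) eq) (ν-p^*-∤ pp v p∤D))
      E≡D : E ≡ D
      E≡D = *-cancelˡ-≡ E D (p ^ i) {{m^n≢0 p i}} (trans eq (cong (λ w → p ^ w * D) (sym i≡v)))

    prime-∤-^-other : ∀ {q} → Prime q → q ≢ p → ∀ i → ¬ (q ∣ p ^ i)
    prime-∤-^-other qq q≢p zero q∣1 = ℕ.nonTrivial⇒≢1 {{prime⇒nonTrivial qq}} (∣1⇒≡1 q∣1)
    prime-∤-^-other qq q≢p (suc i) q∣p^1+i with euclidsLemma p (p ^ i) qq q∣p^1+i
    ... | inj₂ q∣p^i = prime-∤-^-other qq q≢p i q∣p^i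
    ... | inj₁ q∣p with prime⇒irreducible pp q∣p
    ...   | inj₁ q≡1 = ℕ.nonTrivial⇒≢1 {{prime⇒nonTrivial qq}} q≡1
    ...   | inj₂ q≡p = q≢p q≡p


module DivisorSums where

  open import Data.Nat as ℕ using (ℕ; suc; _^_; _≤_; _<_; z≤n; s≤s; pred; NonZero; >-nonZero) renaming (_*_ to _*ₙ_)
  import Data.Nat.Properties as ℕP
  open import Data.Nat.Divisibility
  open import Data.Nat.Primality using (Prime; prime⇒nonZero)
  open import Data.Integer using (ℤ; 1ℤ; _*_)
  import Data.Integer.Properties as ℤP
  open import Data.Product using (_×_; _,_; proj₁; proj₂)
  open import Relation.Nullary using (yes; no; ¬_)
  open import Relation.Binary.PropositionalEquality
  open import Function using (_∘_)
  open import Algebra.Properties.CommutativeSemigroup ℤP.*-commutativeSemigroup using (x∙yz≈y∙xz)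
  open import Defs using (ν)
  open FiniteSums
  open Valuation
  open PrimePowerDivisibility

  open ≡-Reasoning

  -- ∑_{d ∣ n} h d for n ≥ 1; for n = 0 it is the empty sum
  ∑∣ : ℕ → (ℕ → ℤ) → ℤ
  ∑∣ n h = ∑ n (λ i → χ (suc i ∣? n) * h (suc i))

  ∑∣-cong : ∀ n {g h : ℕ → ℤ} → (∀ d → d ∣ n → g d ≡ h d) → ∑∣ n g ≡ ∑∣ n h
  ∑∣-cong n e = ∑-cong n (λ i _ → χ-*-cong (suc i ∣? n) (e (suc i)))

  ∑∣-*ˡ : ∀ n c (g : ℕ → ℤ) → ∑∣ n (λ d → c * g d) ≡ c * ∑∣ n g
  ∑∣-*ˡ n c g = trans (∑-cong n (λ i _ → x∙yz≈y∙xz (χ (suc i ∣? n)) c (g (suc i)))) (∑-*ˡ n c _)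

  ∑∣-*ʳ : ∀ n c (g : ℕ → ℤ) → ∑∣ n (λ d → g d * c) ≡ ∑∣ n g * c
  ∑∣-*ʳ n c g = trans (∑∣-cong n (λ d _ → ℤP.*-comm (g d) c)) (trans (∑∣-*ˡ n c g) (ℤP.*-comm c _))

  ∑∣-∑-comm : ∀ m N (F : ℕ → ℕ → ℤ) → ∑∣ m (λ e → ∑ N (F e)) ≡ ∑ N (λ d → ∑∣ m (λ e → F e d))
  ∑∣-∑-comm m N F = trans (∑-cong m (λ e _ → sym (∑-*ˡ N (χ (suc e ∣? m)) (F (suc e)))))
                          (∑-comm m N (λ e d → χ (suc e ∣? m) * F (suc e) d))

  ∑-δ-suc : ∀ N {X} (g : ℕ → ℤ) → 0 < X → X ≤ N → ∑ N (λ d → χ (suc d ℕ.≟ X) * g (suc d)) ≡ g X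
  ∑-δ-suc N {suc c} g _ X≤N =
    trans (∑-cong N (λ d _ → cong (_* g (suc d)) (χ-cong (suc d ℕ.≟ suc c) (d ℕ.≟ c) ℕP.suc-injective (cong suc))))
          (∑-δ N c (g ∘ suc) X≤N)

  module _ {p : ℕ} (pp : Prime p) where

    private
      instance
        p≢0 : NonZero p
        p≢0 = prime⇒nonZero pp

    -- every divisor of p ^ a * m is p ^ i * e for exactly one i ≤ a and e ∣ m
    ∑-∑∣-χ[D≡p^i*e] : ∀ a {m} → ¬ (p ∣ m) → ∀ D → 0 < D →
      ∑ (suc a) (λ i → ∑∣ m (λ e → χ (D ℕ.≟ p ^ i *ₙ e))) ≡ χ (D ∣? p ^ a *ₙ m)
    ∑-∑∣-χ[D≡p^i*e] a {m} p∤m D D>0 with D ∣? p ^ a *ₙ m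
    ... | no D∤ = ∑-zero (suc a) (λ i i≤a → ∑-zero m (λ e _ → χ*χ-no (suc e ∣? m) (D ℕ.≟ p ^ i *ₙ suc e)
            (λ { (e∣m , refl) → D∤ (p^v*E∣p^a*m⇐ pp (ℕP.≤-pred i≤a) e∣m) })))
    ... | yes D∣ with p-free-part pp D D>0
    ...   | D′ , D≡ , p∤D′ = begin
        ∑ (suc a) (λ i → ∑ m (λ e → χ (suc e ∣? m) * χ (D ℕ.≟ p ^ i *ₙ suc e)))
          ≡⟨ ∑-cong (suc a) (λ i _ → ∑-cong m (λ e _ →
               χ*χ-cong (suc e ∣? m) (D ℕ.≟ p ^ i *ₙ suc e) (i ℕ.≟ v) (e ℕ.≟ pred D′) (to i e) (from i e))) ⟩
        ∑ (suc a) (λ i → ∑ m (λ e → χ (i ℕ.≟ v) * χ (e ℕ.≟ pred D′)))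
          ≡⟨ ∑-cong (suc a) (λ i _ → trans (∑-*ˡ m (χ (i ℕ.≟ v)) _) (cong (χ (i ℕ.≟ v) *_) (∑-χ-≟ m (pred D′) pred-D′<m))) ⟩
        ∑ (suc a) (λ i → χ (i ℕ.≟ v) * 1ℤ)
          ≡⟨ ∑-δ (suc a) v (λ _ → 1ℤ) (s≤s v≤a) ⟩
        1ℤ ∎
      where
      v = ν p D
      instance
        D′≢0 : NonZero D′
        D′≢0 = >-nonZero (∤⇒>0 p∤D′)
      D′-split = p^v*E∣p^a*m⇒ pp v a p∤D′ p∤m (subst (_∣ p ^ a *ₙ m) D≡ D∣)
      v≤a = proj₁ D′-split
      D′∣m = proj₂ D′-split
      pred-D′<m : pred D′ < m
      pred-D′<m = ℕP.≤-trans (ℕP.≤-reflexive (ℕP.suc-pred D′)) (∣⇒≤ {{>-nonZero (∤⇒>0 p∤m)}} D′∣m)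
      to : ∀ i e → suc e ∣ m × D ≡ p ^ i *ₙ suc e → i ≡ v × e ≡ pred D′
      to i e (e∣m , D≡′) with p^i*E≡p^v*D⇒ pp i v (∤⇒∤-divisor p∤m e∣m) p∤D′ (trans (sym D≡′) D≡)
      ... | i≡v , e≡D′ = i≡v , cong pred e≡D′
      from : ∀ i e → i ≡ v × e ≡ pred D′ → suc e ∣ m × D ≡ p ^ i *ₙ suc e
      from i e (refl , refl) = subst (_∣ m) (sym (ℕP.suc-pred D′)) D′∣m ,
                               trans D≡ (cong (p ^ v *ₙ_) (sym (ℕP.suc-pred D′)))

    ∑∣-p^a*m : ∀ a {m} → ¬ (p ∣ m) → (h : ℕ → ℤ) →
      ∑∣ (p ^ a *ₙ m) h ≡ ∑ (suc a) (λ i → ∑∣ m (λ e → h (p ^ i *ₙ e)))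
    ∑∣-p^a*m a {m} p∤m h = sym (begin
        ∑ (suc a) (λ i → ∑∣ m (λ e → h (p ^ i *ₙ e)))
          ≡⟨ ∑-cong (suc a) (λ i i≤a → ∑∣-cong m (λ e e∣m → sym (∑-δ-suc N h (p^i*e>0 i e∣m) (p^i*e≤N i e (ℕP.≤-pred i≤a) e∣m)))) ⟩
        ∑ (suc a) (λ i → ∑∣ m (λ e → ∑ N (λ d → χ (suc d ℕ.≟ p ^ i *ₙ e) * h (suc d))))
          ≡⟨ ∑-cong (suc a) (λ i _ → ∑∣-∑-comm m N (λ e d → χ (suc d ℕ.≟ p ^ i *ₙ e) * h (suc d))) ⟩
        ∑ (suc a) (λ i → ∑ N (λ d → ∑∣ m (λ e → χ (suc d ℕ.≟ p ^ i *ₙ e) * h (suc d))))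
          ≡⟨ ∑-comm (suc a) N (λ i d → ∑∣ m (λ e → χ (suc d ℕ.≟ p ^ i *ₙ e) * h (suc d))) ⟩
        ∑ N (λ d → ∑ (suc a) (λ i → ∑∣ m (λ e → χ (suc d ℕ.≟ p ^ i *ₙ e) * h (suc d))))
          ≡⟨ ∑-cong N (λ d _ → trans (∑-cong (suc a) (λ i _ → ∑∣-*ʳ m (h (suc d)) (λ e → χ (suc d ℕ.≟ p ^ i *ₙ e))))
                                      (∑-*ʳ (suc a) (h (suc d)) (λ i → ∑∣ m (λ e → χ (suc d ℕ.≟ p ^ i *ₙ e))))) ⟩
        ∑ N (λ d → ∑ (suc a) (λ i → ∑∣ m (λ e → χ (suc d ℕ.≟ p ^ i *ₙ e))) * h (suc d))
          ≡⟨ ∑-cong N (λ d _ → cong (_* h (suc d)) (∑-∑∣-χ[D≡p^i*e] a p∤m (suc d) (s≤s z≤n))) ⟩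
        ∑∣ N h ∎)
      where
      N = p ^ a *ₙ m
      p^i*e>0 : ∀ i {e} → e ∣ m → 0 < p ^ i *ₙ e
      p^i*e>0 i e∣m = ℕP.*-mono-< {0} {p ^ i} {0} (ℕP.m^n>0 p i) (∤⇒>0 (∤⇒∤-divisor p∤m e∣m))
      p^i*e≤N : ∀ i e → i ≤ a → e ∣ m → p ^ i *ₙ e ≤ N
      p^i*e≤N i e i≤a e∣m = ℕP.*-mono-≤ (ℕP.^-monoʳ-≤ p i≤a) (∣⇒≤ {{>-nonZero (∤⇒>0 p∤m)}} e∣m)


module PowerDivisorCount where

  open import Data.Nat as ℕ using (ℕ; zero; suc; _^_; _≤_; _<_; pred; _≤?_; NonZero; >-nonZero) renaming (_*_ to _*ₙ_)
  import Data.Nat.Properties as ℕP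
  open import Data.Nat.Divisibility
  open import Data.Nat.Primality using (Prime)
  open import Data.Integer as ℤ using (ℤ; 1ℤ; _*_)
  open import Data.List using (map; upTo; cartesianProduct)
  open import Data.List.Properties using (map-∘; map-cong)
  open import Data.Product using (_×_; _,_; proj₁; proj₂)
  open import Relation.Nullary using (yes; no; ¬_)
  open import Relation.Binary.PropositionalEquality
  open import Function using (_∘_)
  open import Algebra.Properties.CommutativeSemigroup ℕP.*-commutativeSemigroup using (interchange)
  open import Defs using (tau1; range1; sumℤ)
  open FiniteSums
  open PrimePowerDivisibility
  open DivisorSums

  open ≡-Reasoning

  τ₁ : ℕ → ℕ → ℤ
  τ₁ k n = ∑∣ n (λ b → χ (b ^ k ∣? n))

  -- the value of τ₁ k at any prime power p ^ c, namely ⌊c / k⌋ + 1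
  τ₁-pow : ℕ → ℕ → ℤ
  τ₁-pow k c = ∑ (suc c) (λ i → χ (i *ₙ k ≤? c))

  ^-distribʳ-* : ∀ a b k → (a *ₙ b) ^ k ≡ a ^ k *ₙ b ^ k
  ^-distribʳ-* a b zero    = refl
  ^-distribʳ-* a b (suc k) = trans (cong (a *ₙ b *ₙ_) (^-distribʳ-* a b k)) (interchange a b (a ^ k) (b ^ k))

  τ₁-1 : ∀ k → τ₁ k 1 ≡ 1ℤ
  τ₁-1 k rewrite ℕP.^-zeroˡ k = refl

  τ₁-p^c*m : ∀ {p} → Prime p → ∀ k c {m} → ¬ (p ∣ m) → τ₁ k (p ^ c *ₙ m) ≡ τ₁-pow k c * τ₁ k m
  τ₁-p^c*m {p} pp k c {m} p∤m = begin
    τ₁ k (p ^ c *ₙ m)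
      ≡⟨ ∑∣-p^a*m pp c p∤m (λ b → χ (b ^ k ∣? p ^ c *ₙ m)) ⟩
    ∑ (suc c) (λ i → ∑∣ m (λ e → χ ((p ^ i *ₙ e) ^ k ∣? p ^ c *ₙ m)))
      ≡⟨ ∑-cong (suc c) (λ i _ → ∑∣-cong m (λ e e∣m → split i e∣m)) ⟩
    ∑ (suc c) (λ i → ∑∣ m (λ e → χ (i *ₙ k ≤? c) * χ (e ^ k ∣? m)))
      ≡⟨ ∑-cong (suc c) (λ i _ → ∑∣-*ˡ m (χ (i *ₙ k ≤? c)) (λ e → χ (e ^ k ∣? m))) ⟩
    ∑ (suc c) (λ i → χ (i *ₙ k ≤? c) * τ₁ k m)
      ≡⟨ ∑-*ʳ (suc c) (τ₁ k m) (λ i → χ (i *ₙ k ≤? c)) ⟩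
    τ₁-pow k c * τ₁ k m ∎
    where
    split : ∀ i {e} → e ∣ m → χ ((p ^ i *ₙ e) ^ k ∣? p ^ c *ₙ m) ≡ χ (i *ₙ k ≤? c) * χ (e ^ k ∣? m)
    split i {e} e∣m = χ-× ((p ^ i *ₙ e) ^ k ∣? p ^ c *ₙ m) (i *ₙ k ≤? c) (e ^ k ∣? m)
        (p^v*E∣p^a*m⇒ pp (i *ₙ k) c p∤eᵏ p∤m ∘ subst (_∣ p ^ c *ₙ m) eq)
        (λ (ik≤c , eᵏ∣m) → subst (_∣ p ^ c *ₙ m) (sym eq) (p^v*E∣p^a*m⇐ pp ik≤c eᵏ∣m))
      where
      p∤eᵏ : ¬ (p ∣ e ^ k)
      p∤eᵏ = ∤-^ pp k (∤⇒∤-divisor p∤m e∣m)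
      eq : (p ^ i *ₙ e) ^ k ≡ p ^ (i *ₙ k) *ₙ e ^ k
      eq = trans (^-distribʳ-* (p ^ i) e k) (cong (_*ₙ e ^ k) (ℕP.^-*-assoc p i k))

  ∑-χ[a*c≡n] : ∀ n c → 0 < n → 0 < c → ∑ n (λ a → χ (suc a *ₙ c ℕ.≟ n)) ≡ χ (c ∣? n)
  ∑-χ[a*c≡n] n c n>0 c>0 with c ∣? n
  ... | no c∤n = ∑-zero n (λ a _ → χ-no (suc a *ₙ c ℕ.≟ n) (λ e → c∤n (divides (suc a) (sym e))))
  ... | yes (divides q n≡q*c) =
    trans (∑-cong n (λ a _ → χ-cong (suc a *ₙ c ℕ.≟ n) (a ℕ.≟ pred q) to from)) (∑-χ-≟ n (pred q) pred-q<n)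
    where
    instance
      c≢0 : NonZero c
      c≢0 = >-nonZero c>0
      q≢0 : NonZero q
      q≢0 = ℕP.m*n≢0⇒m≢0 q {{subst NonZero n≡q*c (>-nonZero n>0)}}
    to : ∀ {a} → suc a *ₙ c ≡ n → a ≡ pred q
    to {a} e = cong pred (ℕP.*-cancelʳ-≡ (suc a) q c (trans e n≡q*c))
    from : ∀ {a} → a ≡ pred q → suc a *ₙ c ≡ n
    from refl = trans (cong (_*ₙ c) (ℕP.suc-pred q)) (sym n≡q*c)
    pred-q<n : pred q < n
    pred-q<n = ℕP.≤-trans (ℕP.≤-reflexive (ℕP.suc-pred q)) (subst (q ≤_) (sym n≡q*c) (ℕP.m≤m*n q c))

  tau1≡τ₁ : ∀ k n → 1 ≤ k → 0 < n → ℤ.+ tau1 k n ≡ τ₁ k n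
  tau1≡τ₁ (suc k′) n _ n>0 = begin
    ℤ.+ tau1 k n
      ≡⟨ length-filter≡sumℤ-χ P? (cartesianProduct (range1 n) (range1 n)) ⟩
    sumℤ (map (χ ∘ P?) (cartesianProduct (range1 n) (range1 n)))
      ≡⟨ sumℤ-cartesianProduct (χ ∘ P?) (range1 n) (range1 n) ⟩
    sumℤ (map (λ a → sumℤ (map (λ b → χ (a *ₙ b ^ k ℕ.≟ n)) (range1 n))) (range1 n))
      ≡⟨ cong sumℤ (map-cong (λ a → sumℤ-range1 (λ b → χ (a *ₙ b ^ k ℕ.≟ n))) (range1 n)) ⟩
    sumℤ (map (λ a → ∑ n (λ b → χ (a *ₙ suc b ^ k ℕ.≟ n))) (range1 n))
      ≡⟨ sumℤ-range1 (λ a → ∑ n (λ b → χ (a *ₙ suc b ^ k ℕ.≟ n))) ⟩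
    ∑ n (λ a → ∑ n (λ b → χ (suc a *ₙ suc b ^ k ℕ.≟ n)))
      ≡⟨ ∑-comm n n (λ a b → χ (suc a *ₙ suc b ^ k ℕ.≟ n)) ⟩
    ∑ n (λ b → ∑ n (λ a → χ (suc a *ₙ suc b ^ k ℕ.≟ n)))
      ≡⟨ ∑-cong n (λ b _ → ∑-χ[a*c≡n] n (suc b ^ k) n>0 (ℕP.m^n>0 (suc b) k)) ⟩
    ∑ n (λ b → χ (suc b ^ k ∣? n))
      ≡⟨ ∑-cong n (λ b _ → χ-× (suc b ^ k ∣? n) (suc b ∣? n) (suc b ^ k ∣? n) (λ bᵏ∣n → ∣-trans (m∣m*n (suc b ^ k′)) bᵏ∣n , bᵏ∣n) proj₂) ⟩
    τ₁ k n ∎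
    where
    k = suc k′
    P? = λ (ab : ℕ × ℕ) → proj₁ ab *ₙ proj₂ ab ^ k ℕ.≟ n
    sumℤ-range1 : (g : ℕ → ℤ) → sumℤ (map g (range1 n)) ≡ ∑ n (g ∘ suc)
    sumℤ-range1 g = trans (cong sumℤ (sym (map-∘ (upTo n)))) (sumℤ-map-upTo n (g ∘ suc))


module FkMultiplicative where

  open import Data.Nat as ℕ using (ℕ; zero; suc; _^_; _≤_; _<_; z≤n; s≤s; NonZero; >-nonZero) renaming (_*_ to _*ₙ_)
  import Data.Nat.Properties as ℕP
  open import Data.Nat.Divisibility
  open import Data.Nat.Primality using (Prime; prime?; prime⇒nonZero)
  open import Data.Integer using (ℤ; 1ℤ; _*_)
  import Data.Integer.Properties as ℤP
  open import Data.List using (filter; applyUpTo; foldr)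
  open import Relation.Nullary using (Dec; yes; no; ¬_)
  open import Relation.Binary.PropositionalEquality
  open import Function using (_∘_; id)
  open import Data.Empty using (⊥-elim)
  open import Algebra.Properties.CommutativeSemigroup ℤP.*-commutativeSemigroup using (x∙yz≈y∙xz)
  open import Defs using (ν; fk; fLocal)
  open Valuation
  open PrimePowerDivisibility

  open ≡-Reasoning

  ∏ : ℕ → (ℕ → ℤ) → ℤ
  ∏ zero    g = 1ℤ
  ∏ (suc N) g = g 0 * ∏ N (g ∘ suc)

  ∏-cong : ∀ N {g h : ℕ → ℤ} → (∀ i → i < N → g i ≡ h i) → ∏ N g ≡ ∏ N h
  ∏-cong zero    _ = refl
  ∏-cong (suc N) e = cong₂ _*_ (e 0 (s≤s z≤n)) (∏-cong N (λ i i<N → e (suc i) (s≤s i<N)))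

  ∏-extend : ∀ N M (g : ℕ → ℤ) → N ≤ M → (∀ i → N ≤ i → i < M → g i ≡ 1ℤ) → ∏ M g ≡ ∏ N g
  ∏-extend zero    zero    g _         _ = refl
  ∏-extend zero    (suc M) g _         e =
    cong₂ _*_ (e 0 z≤n (s≤s z≤n)) (∏-extend 0 M (g ∘ suc) z≤n (λ i _ i<M → e (suc i) z≤n (s≤s i<M)))
  ∏-extend (suc N) (suc M) g (s≤s N≤M) e =
    cong (g 0 *_) (∏-extend N M (g ∘ suc) N≤M (λ i N≤i i<M → e (suc i) (s≤s N≤i) (s≤s i<M)))

  ∏-pick : ∀ N c (g h : ℕ → ℤ) → c < N → h c ≡ 1ℤ → (∀ i → i < N → i ≢ c → g i ≡ h i) → ∏ N g ≡ g c * ∏ N h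
  ∏-pick (suc N) zero g h _ h0≡1 e = begin
    g 0 * ∏ N (g ∘ suc)        ≡⟨ cong (g 0 *_) (∏-cong N (λ i i<N → e (suc i) (s≤s i<N) λ ())) ⟩
    g 0 * ∏ N (h ∘ suc)        ≡⟨ cong (g 0 *_) (sym (ℤP.*-identityˡ _)) ⟩
    g 0 * (1ℤ * ∏ N (h ∘ suc)) ≡⟨ cong (λ x → g 0 * (x * ∏ N (h ∘ suc))) (sym h0≡1) ⟩
    g 0 * (h 0 * ∏ N (h ∘ suc)) ∎
  ∏-pick (suc N) (suc c) g h (s≤s c<N) hc≡1 e = begin
    g 0 * ∏ N (g ∘ suc)
      ≡⟨ cong (g 0 *_) (∏-pick N c (g ∘ suc) (h ∘ suc) c<N hc≡1 (λ i i<N i≢c → e (suc i) (s≤s i<N) (i≢c ∘ ℕP.suc-injective))) ⟩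
    g 0 * (g (suc c) * ∏ N (h ∘ suc)) ≡⟨ x∙yz≈y∙xz (g 0) (g (suc c)) _ ⟩
    g (suc c) * (g 0 * ∏ N (h ∘ suc)) ≡⟨ cong (λ x → g (suc c) * (x * ∏ N (h ∘ suc))) (e 0 (s≤s z≤n) λ ()) ⟩
    g (suc c) * (h 0 * ∏ N (h ∘ suc)) ∎

  when : ∀ {ℓ} {P : Set ℓ} → Dec P → ℤ → ℤ
  when (yes _) x = x
  when (no _)  _ = 1ℤ

  foldr-filter≡∏ : ∀ (F : ℕ → ℤ) f N →
    foldr (λ p acc → F p * acc) 1ℤ (filter prime? (applyUpTo f N)) ≡ ∏ N (λ i → when (prime? (f i)) (F (f i)))
  foldr-filter≡∏ F f zero = refl
  foldr-filter≡∏ F f (suc N) with prime? (f 0)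
  ... | yes _ = cong (F (f 0) *_) (foldr-filter≡∏ F (f ∘ suc) N)
  ... | no  _ = trans (foldr-filter≡∏ F (f ∘ suc) N) (sym (ℤP.*-identityˡ _))

  fk-factor : ℕ → ℕ → ℕ → ℕ → ℤ
  fk-factor k d₁ d₂ q = when (prime? q) (fLocal k (ν q d₁) (ν q d₂))

  -- primes beyond d₁ * d₂ divide neither argument, so their factors are 1
  fk≡∏ : ∀ k {d₁ d₂} M → 0 < d₁ → 0 < d₂ → d₁ *ₙ d₂ < M → fk k d₁ d₂ ≡ ∏ M (fk-factor k d₁ d₂)
  fk≡∏ k {d₁} {d₂} M d₁>0 d₂>0 d₁d₂<M = sym (begin
    ∏ M (fk-factor k d₁ d₂)                   ≡⟨ ∏-extend (suc (d₁ *ₙ d₂)) M (fk-factor k d₁ d₂) d₁d₂<M trivial ⟩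
    ∏ (suc (d₁ *ₙ d₂)) (fk-factor k d₁ d₂)    ≡⟨ sym (foldr-filter≡∏ (λ q → fLocal k (ν q d₁) (ν q d₂)) id (suc (d₁ *ₙ d₂))) ⟩
    fk k d₁ d₂                                ∎)
    where
    ν-large : ∀ {q d} → Prime q → 0 < d → d < q → ν q d ≡ 0
    ν-large {q} {d} qq d>0 d<q = ν-∤ qq (λ q∣d → ℕP.<⇒≱ d<q (∣⇒≤ {{>-nonZero d>0}} q∣d))
    trivial : ∀ q → suc (d₁ *ₙ d₂) ≤ q → q < M → fk-factor k d₁ d₂ q ≡ 1ℤ
    trivial q d₁d₂<q _ with prime? q
    ... | no  _  = refl
    ... | yes qq = cong₂ (fLocal k)
      (ν-large qq d₁>0 (ℕP.≤-trans (s≤s (ℕP.m≤m*n d₁ d₂ {{>-nonZero d₂>0}})) d₁d₂<q))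
      (ν-large qq d₂>0 (ℕP.≤-trans (s≤s (ℕP.m≤n*m d₂ d₁ {{>-nonZero d₁>0}})) d₁d₂<q))

  module _ {p : ℕ} (pp : Prime p) (k : ℕ) {e₁ e₂ : ℕ} (p∤e₁ : ¬ (p ∣ e₁)) (p∤e₂ : ¬ (p ∣ e₂)) where

    fk-factor-at-p : ∀ i j → fk-factor k (p ^ i *ₙ e₁) (p ^ j *ₙ e₂) p ≡ fLocal k i j
    fk-factor-at-p i j with prime? p
    ... | yes _  = cong₂ (fLocal k) (ν-p^*-∤ pp i p∤e₁) (ν-p^*-∤ pp j p∤e₂)
    ... | no ¬pp = ⊥-elim (¬pp pp)

    fk-factor-at-p-∤ : fk-factor k e₁ e₂ p ≡ 1ℤ
    fk-factor-at-p-∤ with prime? p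
    ... | yes _ = cong₂ (fLocal k) (ν-∤ pp p∤e₁) (ν-∤ pp p∤e₂)
    ... | no  _ = refl

    fk-factor-away-from-p : ∀ i j q → q ≢ p → fk-factor k (p ^ i *ₙ e₁) (p ^ j *ₙ e₂) q ≡ fk-factor k e₁ e₂ q
    fk-factor-away-from-p i j q q≢p with prime? q
    ... | no  _  = refl
    ... | yes qq = cong₂ (fLocal k) (ν-*-∤ qq e₁ (prime-∤-^-other pp qq q≢p i) (∤⇒>0 p∤e₁))
                                    (ν-*-∤ qq e₂ (prime-∤-^-other pp qq q≢p j) (∤⇒>0 p∤e₂))

    -- M = p d₁ d₂ + 1 exceeds p and both products of arguments, so one product over q < M serves all
    fk-p^i*e : ∀ i j → fk k (p ^ i *ₙ e₁) (p ^ j *ₙ e₂) ≡ fLocal k i j * fk k e₁ e₂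
    fk-p^i*e i j = begin
      fk k d₁ d₂                                    ≡⟨ fk≡∏ k M d₁>0 d₂>0 (s≤s X≤p*X) ⟩
      ∏ M (fk-factor k d₁ d₂)                       ≡⟨ ∏-pick M p (fk-factor k d₁ d₂) (fk-factor k e₁ e₂) p<M
                                                         fk-factor-at-p-∤ (λ q _ → fk-factor-away-from-p i j q) ⟩
      fk-factor k d₁ d₂ p * ∏ M (fk-factor k e₁ e₂) ≡⟨ cong₂ _*_ (fk-factor-at-p i j)
                                                         (sym (fk≡∏ k M e₁>0 e₂>0 (s≤s (ℕP.≤-trans e₁e₂≤X X≤p*X)))) ⟩
      fLocal k i j * fk k e₁ e₂                     ∎
      where
      instance
        p≢0 : NonZero p
        p≢0 = prime⇒nonZero pp
      d₁ = p ^ i *ₙ e₁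
      d₂ = p ^ j *ₙ e₂
      X = d₁ *ₙ d₂
      M = suc (p *ₙ X)
      e₁>0 = ∤⇒>0 p∤e₁
      e₂>0 = ∤⇒>0 p∤e₂
      d₁>0 = ℕP.*-mono-< {0} {p ^ i} {0} (ℕP.m^n>0 p i) e₁>0
      d₂>0 = ℕP.*-mono-< {0} {p ^ j} {0} (ℕP.m^n>0 p j) e₂>0
      X≤p*X : X ≤ p *ₙ X
      X≤p*X = ℕP.m≤n*m X p
      p<M : p < M
      p<M = s≤s (ℕP.m≤m*n p X {{>-nonZero (ℕP.*-mono-< {0} {d₁} {0} d₁>0 d₂>0)}})
      e₁e₂≤X : e₁ *ₙ e₂ ≤ X
      e₁e₂≤X = ℕP.*-mono-≤ (ℕP.m≤n*m e₁ (p ^ i) {{ℕP.m^n≢0 p i}}) (ℕP.m≤n*m e₂ (p ^ j) {{ℕP.m^n≢0 p j}})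


module LocalIdentity where

  open import Data.Nat as ℕ using (ℕ; zero; suc; _∸_; _≤_; _<_; z≤n; s≤s; _≤?_; _<?_; >-nonZero) renaming (_*_ to _*ₙ_; _+_ to _+ₙ_)
  import Data.Nat.Properties as ℕP
  open import Data.Integer using (ℤ; 0ℤ; 1ℤ; _+_; _*_; -_; _-_)
  import Data.Integer.Properties as ℤP
  open import Data.Integer.Solver using (module +-*-Solver)
  open import Data.Product using (_×_; _,_; proj₂)
  open import Data.Sum using ([_,_]) renaming (map to map-⊎)
  open import Relation.Nullary using (Dec; yes; no; does; ¬_)
  open import Relation.Binary.PropositionalEquality hiding ([_])
  open import Data.Empty using (⊥-elim)
  open import Function using (_∘_)
  open import Data.Bool using (if_then_else_)
  open import Defs using (fLocal)
  open +-*-Solver using (solve; _:+_; _:*_; _:-_; _:=_; con; :-_)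
  open FiniteSums
  open DivisorSums using (∑-δ-suc)
  open PowerDivisorCount using (τ₁-pow)

  open ≡-Reasoning

  τ₁-pow-< : ∀ k c → c < k → τ₁-pow k c ≡ 1ℤ
  τ₁-pow-< k c c<k = trans (cong (1ℤ +_) (∑-zero c λ i _ → χ-no (suc i *ₙ k ≤? c) (too-big i))) (ℤP.+-identityʳ 1ℤ)
    where
    too-big : ∀ i → ¬ (suc i *ₙ k ≤ c)
    too-big i le = ℕP.<⇒≱ c<k (ℕP.≤-trans (ℕP.m≤m+n k (i *ₙ k)) le)

  τ₁-pow-+k : ∀ k c → 1 ≤ k → τ₁-pow k (c +ₙ k) ≡ τ₁-pow k c + 1ℤ
  τ₁-pow-+k k c k≥1 = begin
    1ℤ + ∑ (c +ₙ k) (λ i → χ (suc i *ₙ k ≤? c +ₙ k))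
      ≡⟨ cong (1ℤ +_) (∑-cong (c +ₙ k) (λ i _ → χ-cong (suc i *ₙ k ≤? c +ₙ k) (i *ₙ k ≤? c) (to i) (from i))) ⟩
    1ℤ + ∑ (c +ₙ k) (λ i → χ (i *ₙ k ≤? c))
      ≡⟨ cong (1ℤ +_) (∑-extend (suc c) (c +ₙ k) (λ i → χ (i *ₙ k ≤? c)) c<c+k beyond) ⟩
    1ℤ + τ₁-pow k c ≡⟨ ℤP.+-comm 1ℤ (τ₁-pow k c) ⟩
    τ₁-pow k c + 1ℤ ∎
    where
    to : ∀ i → suc i *ₙ k ≤ c +ₙ k → i *ₙ k ≤ c
    to i le = ℕP.+-cancelʳ-≤ k (i *ₙ k) c (subst (_≤ c +ₙ k) (ℕP.+-comm k (i *ₙ k)) le)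
    from : ∀ i → i *ₙ k ≤ c → suc i *ₙ k ≤ c +ₙ k
    from i le = subst (_≤ c +ₙ k) (ℕP.+-comm (i *ₙ k) k) (ℕP.+-monoˡ-≤ k le)
    c<c+k : suc c ≤ c +ₙ k
    c<c+k = subst (_≤ c +ₙ k) (ℕP.+-comm c 1) (ℕP.+-monoʳ-≤ c k≥1)
    beyond : ∀ i → suc c ≤ i → i < c +ₙ k → χ (i *ₙ k ≤? c) ≡ 0ℤ
    beyond i c<i _ = χ-no (i *ₙ k ≤? c) (λ le → ℕP.<⇒≱ c<i (ℕP.≤-trans (ℕP.m≤m*n i k {{>-nonZero k≥1}}) le))

  τ₁-pow-<2k : ∀ k c → 1 ≤ k → c < k +ₙ k → τ₁-pow k c ≡ 1ℤ + χ (k ≤? c)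
  τ₁-pow-<2k k c k≥1 c<2k with k ≤? c
  ... | no  k≰c = trans (τ₁-pow-< k c (ℕP.≰⇒> k≰c)) (sym (ℤP.+-identityʳ 1ℤ))
  ... | yes k≤c = begin
    τ₁-pow k c               ≡⟨ cong (τ₁-pow k) (sym (ℕP.m∸n+n≡m k≤c)) ⟩
    τ₁-pow k (c ∸ k +ₙ k)    ≡⟨ τ₁-pow-+k k (c ∸ k) k≥1 ⟩
    τ₁-pow k (c ∸ k) + 1ℤ    ≡⟨ cong (_+ 1ℤ) (τ₁-pow-< k (c ∸ k) c∸k<k) ⟩
    1ℤ + 1ℤ                  ∎
    where
    c∸k<k : c ∸ k < k
    c∸k<k = ℕP.+-cancelʳ-< k (c ∸ k) k (subst (_< k +ₙ k) (sym (ℕP.m∸n+n≡m k≤c)) c<2k)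

  χ-≤-suc : ∀ t y → χ (t ≤? suc y) ≡ χ (t ≤? y) + χ (suc y ℕ.≟ t)
  χ-≤-suc t y = χ-⊎ (t ≤? suc y) (t ≤? y) (suc y ℕ.≟ t)
    (λ t≤1+y → map-⊎ ℕP.≤-pred sym (ℕP.m≤n⇒m<n∨m≡n t≤1+y))
    [ ℕP.m≤n⇒m≤1+n , (λ e → ℕP.≤-reflexive (sym e)) ]
    (λ (t≤y , 1+y≡t) → ℕP.<-irrefl (sym 1+y≡t) (s≤s t≤y))

  χ-≤-≟ : ∀ t y → χ (t ≤? y) ≡ χ (suc t ≤? y) + χ (t ℕ.≟ y)
  χ-≤-≟ t y = χ-⊎ (t ≤? y) (suc t ≤? y) (t ℕ.≟ y) ℕP.m≤n⇒m<n∨m≡n [ ℕP.<⇒≤ , ℕP.≤-reflexive ]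
    (λ (t<y , t≡y) → ℕP.<-irrefl t≡y t<y)

  ∑-χ[1+i+c≡t] : ∀ x c t → ∑ x (λ i → χ (suc i +ₙ c ℕ.≟ t)) ≡ χ (c <? t) * χ (t ≤? x +ₙ c)
  ∑-χ[1+i+c≡t] zero    c t = sym (χ*χ-no (c <? t) (t ≤? c) (λ (c<t , t≤c) → ℕP.<⇒≱ c<t t≤c))
  ∑-χ[1+i+c≡t] (suc x) c t = begin
    ∑ (suc x) (λ i → χ (suc i +ₙ c ℕ.≟ t))     ≡⟨ ∑-snoc x (λ i → χ (suc i +ₙ c ℕ.≟ t)) ⟩
    ∑ x (λ i → χ (suc i +ₙ c ℕ.≟ t)) + e        ≡⟨ cong₂ _+_ (∑-χ[1+i+c≡t] x c t) (χ-× e? (c <? t) e? c<t∧e proj₂) ⟩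
    χ (c <? t) * χ (t ≤? x +ₙ c) + χ (c <? t) * e ≡⟨ sym (ℤP.*-distribˡ-+ (χ (c <? t)) _ e) ⟩
    χ (c <? t) * (χ (t ≤? x +ₙ c) + e)         ≡⟨ cong (χ (c <? t) *_) (sym (χ-≤-suc t (x +ₙ c))) ⟩
    χ (c <? t) * χ (t ≤? suc x +ₙ c)           ∎
    where
    e? = suc x +ₙ c ℕ.≟ t
    e = χ e?
    c<t∧e : suc x +ₙ c ≡ t → c < t × suc x +ₙ c ≡ t
    c<t∧e refl = s≤s (ℕP.m≤n+m c x) , refl

  fLocal-suc-suc : ∀ k a b → fLocal k (suc a) (suc b) ≡ χ (suc a +ₙ suc b ℕ.≟ k) - χ (suc a +ₙ suc b ℕ.≟ suc k)
  fLocal-suc-suc k a b = if-χ (suc a +ₙ suc b ℕ.≟ k) (suc a +ₙ suc b ℕ.≟ suc k) (λ (e₁ , e₂) → ℕP.<-irrefl (trans (sym e₁) e₂) (ℕP.n<1+n k))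
    where
    if-χ : ∀ {ℓ₁ ℓ₂} {P : Set ℓ₁} {Q : Set ℓ₂} (d : Dec P) (e : Dec Q) → ¬ (P × Q) →
      (if does d then 1ℤ else (if does e then - 1ℤ else 0ℤ)) ≡ χ d - χ e
    if-χ (yes p) (yes q) ¬pq = ⊥-elim (¬pq (p , q))
    if-χ (yes _) (no _)  _   = refl
    if-χ (no _)  (yes _) _   = refl
    if-χ (no _)  (no _)  _   = refl

  fLocal-comm : ∀ k i j → fLocal k i j ≡ fLocal k j i
  fLocal-comm k zero    zero    = refl
  fLocal-comm k zero    (suc j) = refl
  fLocal-comm k (suc i) zero    = refl
  fLocal-comm k (suc i) (suc j) = begin
    fLocal k (suc i) (suc j)                                ≡⟨ fLocal-suc-suc k i j ⟩
    χ (suc i +ₙ suc j ℕ.≟ k) - χ (suc i +ₙ suc j ℕ.≟ suc k) ≡⟨ cong₂ _-_ (swap k) (swap (suc k)) ⟩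
    χ (suc j +ₙ suc i ℕ.≟ k) - χ (suc j +ₙ suc i ℕ.≟ suc k) ≡⟨ sym (fLocal-suc-suc k j i) ⟩
    fLocal k (suc j) (suc i)                                ∎
    where
    swap : ∀ t → χ (suc i +ₙ suc j ℕ.≟ t) ≡ χ (suc j +ₙ suc i ℕ.≟ t)
    swap t = χ-cong (suc i +ₙ suc j ℕ.≟ t) (suc j +ₙ suc i ℕ.≟ t)
               (trans (ℕP.+-comm (suc j) (suc i))) (trans (ℕP.+-comm (suc i) (suc j)))

  ∑fLocal : ℕ → ℕ → ℕ → ℤ
  ∑fLocal k x j = ∑ (suc x) (λ i → fLocal k i j)

  ∑fLocal-zero : ∀ k x → ∑fLocal k x 0 ≡ 1ℤ
  ∑fLocal-zero k x = cong (1ℤ +_) (∑-zero x (λ _ _ → refl))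

  ∑fLocal-suc : ∀ k x j → ∑fLocal k x (suc j) ≡
    χ (suc j <? k) * χ (k ≤? x +ₙ suc j) - χ (suc j <? suc k) * χ (suc k ≤? x +ₙ suc j)
  ∑fLocal-suc k x j = begin
    0ℤ + ∑ x (λ i → fLocal k (suc i) (suc j))
      ≡⟨ ℤP.+-identityˡ _ ⟩
    ∑ x (λ i → fLocal k (suc i) (suc j))
      ≡⟨ ∑-cong x (λ i _ → fLocal-suc-suc k i j) ⟩
    ∑ x (λ i → χ (suc i +ₙ suc j ℕ.≟ k) - χ (suc i +ₙ suc j ℕ.≟ suc k))
      ≡⟨ ∑-minus x (λ i → χ (suc i +ₙ suc j ℕ.≟ k)) (λ i → χ (suc i +ₙ suc j ℕ.≟ suc k)) ⟩
    ∑ x (λ i → χ (suc i +ₙ suc j ℕ.≟ k)) - ∑ x (λ i → χ (suc i +ₙ suc j ℕ.≟ suc k))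
      ≡⟨ cong₂ _-_ (∑-χ[1+i+c≡t] x (suc j) k) (∑-χ[1+i+c≡t] x (suc j) (suc k)) ⟩
    χ (suc j <? k) * χ (k ≤? x +ₙ suc j) - χ (suc j <? suc k) * χ (suc k ≤? x +ₙ suc j) ∎

  ∑fLocal-suc-≥ : ∀ k x j → k ≤ x → ∑fLocal k x (suc j) ≡ - χ (suc j ℕ.≟ k)
  ∑fLocal-suc-≥ k x j k≤x = begin
    ∑fLocal k x (suc j)
      ≡⟨ ∑fLocal-suc k x j ⟩
    χ (suc j <? k) * χ (k ≤? y) - χ (suc j <? suc k) * χ (suc k ≤? y)
      ≡⟨ cong₂ _-_ (*-χ-yes (χ (suc j <? k)) (k ≤? y) (ℕP.≤-trans k≤x (ℕP.m≤m+n x (suc j))))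
                   (*-χ-yes (χ (suc j <? suc k)) (suc k ≤? y) (subst (_≤ y) (ℕP.+-comm k 1) (ℕP.+-mono-≤ k≤x (s≤s z≤n)))) ⟩
    χ (suc j <? k) - χ (suc (suc j) ≤? suc k)
      ≡⟨ cong (λ v → χ (suc j <? k) - v) (χ-≤-suc (suc (suc j)) k) ⟩
    χ (suc j <? k) - (χ (suc j <? k) + χ (suc k ℕ.≟ suc (suc j)))
      ≡⟨ solve 2 (λ u v → u :- (u :+ v) := :- v) refl (χ (suc j <? k)) _ ⟩
    - χ (suc k ℕ.≟ suc (suc j))
      ≡⟨ cong -_ (χ-cong (suc k ℕ.≟ suc (suc j)) (suc j ℕ.≟ k) (sym ∘ ℕP.suc-injective) (cong suc ∘ sym)) ⟩
    - χ (suc j ℕ.≟ k) ∎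
    where
    y = x +ₙ suc j

  ∑fLocal-suc-< : ∀ k x j → suc j < k → ∑fLocal k x (suc j) ≡ χ (suc j +ₙ x ℕ.≟ k)
  ∑fLocal-suc-< k x j 1+j<k = begin
    ∑fLocal k x (suc j)
      ≡⟨ ∑fLocal-suc k x j ⟩
    χ (suc j <? k) * χ (k ≤? y) - χ (suc j <? suc k) * χ (suc k ≤? y)
      ≡⟨ cong₂ _-_ (χ-yes-* (suc j <? k) (χ (k ≤? y)) 1+j<k) (χ-yes-* (suc j <? suc k) (χ (suc k ≤? y)) (ℕP.m≤n⇒m≤1+n 1+j<k)) ⟩
    χ (k ≤? y) - χ (suc k ≤? y)
      ≡⟨ cong (_- χ (suc k ≤? y)) (χ-≤-≟ k y) ⟩
    χ (suc k ≤? y) + χ (k ℕ.≟ y) - χ (suc k ≤? y)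
      ≡⟨ solve 2 (λ u v → u :+ v :- u := v) refl (χ (suc k ≤? y)) _ ⟩
    χ (k ℕ.≟ y)
      ≡⟨ χ-cong (k ℕ.≟ y) (suc j +ₙ x ℕ.≟ k) (λ e → trans (ℕP.+-comm (suc j) x) (sym e)) (λ e → trans (sym e) (ℕP.+-comm (suc j) x)) ⟩
    χ (suc j +ₙ x ℕ.≟ k) ∎
    where
    y = x +ₙ suc j

  localSum : ℕ → ℕ → ℕ → ℤ
  localSum k a b = ∑ (suc a) (λ i → ∑ (suc b) (λ j → fLocal k i j * τ₁-pow k (a ∸ i) * τ₁-pow k (b ∸ j)))

  localSum-comm : ∀ k a b → localSum k a b ≡ localSum k b a
  localSum-comm k a b = trans (∑-comm (suc a) (suc b) (λ i j → fLocal k i j * τ₁-pow k (a ∸ i) * τ₁-pow k (b ∸ j)))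
                              (∑-cong (suc b) (λ j _ → ∑-cong (suc a) (λ i _ → swap i j)))
    where
    swap : ∀ i j → fLocal k i j * τ₁-pow k (a ∸ i) * τ₁-pow k (b ∸ j) ≡ fLocal k j i * τ₁-pow k (b ∸ j) * τ₁-pow k (a ∸ i)
    swap i j = trans (cong (λ f → f * τ₁-pow k (a ∸ i) * τ₁-pow k (b ∸ j)) (fLocal-comm k i j))
                     (solve 3 (λ f x y → f :* x :* y := f :* y :* x) refl (fLocal k j i) (τ₁-pow k (a ∸ i)) (τ₁-pow k (b ∸ j)))

  ∑-∑fLocal*τ₁-pow : ∀ k x b → 1 ≤ k → k ≤ x → ∑ (suc b) (λ j → ∑fLocal k x j * τ₁-pow k (b ∸ j)) ≡ 1ℤ
  ∑-∑fLocal*τ₁-pow k x b k≥1 k≤x = begin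
    ∑fLocal k x 0 * τ₁-pow k b + ∑ b (λ j → ∑fLocal k x (suc j) * τ₁-pow k (b ∸ suc j))
      ≡⟨ cong₂ _+_ (trans (cong (_* τ₁-pow k b) (∑fLocal-zero k x)) (ℤP.*-identityˡ (τ₁-pow k b)))
                   (∑-cong b (λ j _ → trans (cong (_* τ₁-pow k (b ∸ suc j)) (∑fLocal-suc-≥ k x j k≤x))
                                            (sym (ℤP.neg-distribˡ-* (χ (suc j ℕ.≟ k)) _)))) ⟩
    τ₁-pow k b + ∑ b (λ j → - (χ (suc j ℕ.≟ k) * τ₁-pow k (b ∸ suc j)))
      ≡⟨ cong (τ₁-pow k b +_) (∑-neg b (λ j → χ (suc j ℕ.≟ k) * τ₁-pow k (b ∸ suc j))) ⟩
    τ₁-pow k b - ∑ b (λ j → χ (suc j ℕ.≟ k) * τ₁-pow k (b ∸ suc j))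
      ≡⟨ difference ⟩
    1ℤ ∎
    where
    difference : τ₁-pow k b - ∑ b (λ j → χ (suc j ℕ.≟ k) * τ₁-pow k (b ∸ suc j)) ≡ 1ℤ
    difference with k ≤? b
    ... | yes k≤b = begin
      τ₁-pow k b - ∑ b (λ j → χ (suc j ℕ.≟ k) * τ₁-pow k (b ∸ suc j))
        ≡⟨ cong (λ s → τ₁-pow k b - s) (∑-δ-suc b (λ t → τ₁-pow k (b ∸ t)) k≥1 k≤b) ⟩
      τ₁-pow k b - τ₁-pow k (b ∸ k)
        ≡⟨ cong (_- τ₁-pow k (b ∸ k)) (trans (cong (τ₁-pow k) (sym (ℕP.m∸n+n≡m k≤b))) (τ₁-pow-+k k (b ∸ k) k≥1)) ⟩
      τ₁-pow k (b ∸ k) + 1ℤ - τ₁-pow k (b ∸ k)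
        ≡⟨ solve 1 (λ u → u :+ con 1ℤ :- u := con 1ℤ) refl (τ₁-pow k (b ∸ k)) ⟩
      1ℤ ∎
    ... | no k≰b = cong₂ _-_ (τ₁-pow-< k b (ℕP.≰⇒> k≰b))
      (∑-zero b (λ j j<b → trans (cong (_* τ₁-pow k (b ∸ suc j)) (χ-no (suc j ℕ.≟ k) (λ e → k≰b (subst (_≤ b) e j<b))))
                                 (ℤP.*-zeroˡ (τ₁-pow k (b ∸ suc j)))))

  τ₁-pow-+k-∸ : ∀ k a i → 1 ≤ k → i ≤ a +ₙ k → τ₁-pow k (a +ₙ k ∸ i) ≡ χ (i ≤? a) * τ₁-pow k (a ∸ i) + 1ℤ
  τ₁-pow-+k-∸ k a i k≥1 i≤a+k with i ≤? a
  ... | yes i≤a = trans (cong (τ₁-pow k) (ℕP.+-∸-comm k i≤a))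
                        (trans (τ₁-pow-+k k (a ∸ i) k≥1) (cong (_+ 1ℤ) (sym (ℤP.*-identityˡ (τ₁-pow k (a ∸ i))))))
  ... | no  i≰a = trans (τ₁-pow-< k (a +ₙ k ∸ i) a+k∸i<k) (sym (cong (_+ 1ℤ) (ℤP.*-zeroˡ (τ₁-pow k (a ∸ i)))))
    where
    a+k∸i<k : a +ₙ k ∸ i < k
    a+k∸i<k = subst (a +ₙ k ∸ i <_) (ℕP.m+n∸m≡n a k) (ℕP.∸-monoʳ-< (ℕP.≰⇒> i≰a) i≤a+k)

  localSum-+k : ∀ k a b → 1 ≤ k → localSum k (a +ₙ k) b ≡ localSum k a b + 1ℤ
  localSum-+k k a b k≥1 = begin
    ∑ (suc A) (λ i → ∑ (suc b) (λ j → F i j * τ₁-pow k (A ∸ i) * τ₁-pow k (b ∸ j)))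
      ≡⟨ ∑-cong (suc A) (λ i i≤A → ∑-cong (suc b) (λ j _ → split i j (ℕP.≤-pred i≤A))) ⟩
    ∑ (suc A) (λ i → ∑ (suc b) (λ j → [i≤a] i * W i j + F i j * τ₁-pow k (b ∸ j)))
      ≡⟨ ∑-cong (suc A) (λ i _ → trans (∑-+ (suc b) (λ j → [i≤a] i * W i j) (λ j → F i j * τ₁-pow k (b ∸ j)))
                                       (cong (_+ V i) (∑-*ˡ (suc b) ([i≤a] i) (W i)))) ⟩
    ∑ (suc A) (λ i → [i≤a] i * ∑ (suc b) (W i) + V i)
      ≡⟨ ∑-+ (suc A) (λ i → [i≤a] i * ∑ (suc b) (W i)) V ⟩
    ∑ (suc A) (λ i → [i≤a] i * ∑ (suc b) (W i)) + ∑ (suc A) V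
      ≡⟨ cong₂ _+_ truncate (∑-∑fLocal-τ₁-pow) ⟩
    localSum k a b + 1ℤ ∎
    where
    A = a +ₙ k
    F = fLocal k
    [i≤a] : ℕ → ℤ
    [i≤a] i = χ (i ≤? a)
    W : ℕ → ℕ → ℤ
    W i j = F i j * τ₁-pow k (a ∸ i) * τ₁-pow k (b ∸ j)
    V : ℕ → ℤ
    V i = ∑ (suc b) (λ j → F i j * τ₁-pow k (b ∸ j))
    split : ∀ i j → i ≤ A → F i j * τ₁-pow k (A ∸ i) * τ₁-pow k (b ∸ j) ≡ [i≤a] i * W i j + F i j * τ₁-pow k (b ∸ j)
    split i j i≤A = trans (cong (λ t → F i j * t * τ₁-pow k (b ∸ j)) (τ₁-pow-+k-∸ k a i k≥1 i≤A))
      (solve 4 (λ f c t s → f :* (c :* t :+ con 1ℤ) :* s := c :* (f :* t :* s) :+ f :* s) refl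
             (F i j) ([i≤a] i) (τ₁-pow k (a ∸ i)) (τ₁-pow k (b ∸ j)))
    truncate : ∑ (suc A) (λ i → [i≤a] i * ∑ (suc b) (W i)) ≡ localSum k a b
    truncate = trans (∑-extend (suc a) (suc A) (λ i → [i≤a] i * ∑ (suc b) (W i)) (s≤s (ℕP.m≤m+n a k))
                        (λ i a<i _ → trans (cong (_* ∑ (suc b) (W i)) (χ-no (i ≤? a) (ℕP.<⇒≱ a<i))) (ℤP.*-zeroˡ (∑ (suc b) (W i)))))
                     (∑-cong (suc a) (λ i i≤a → χ-yes-* (i ≤? a) (∑ (suc b) (W i)) (ℕP.≤-pred i≤a)))
    ∑-∑fLocal-τ₁-pow : ∑ (suc A) V ≡ 1ℤ
    ∑-∑fLocal-τ₁-pow = begin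
      ∑ (suc A) V                                         ≡⟨ ∑-comm (suc A) (suc b) (λ i j → F i j * τ₁-pow k (b ∸ j)) ⟩
      ∑ (suc b) (λ j → ∑ (suc A) (λ i → F i j * τ₁-pow k (b ∸ j))) ≡⟨ ∑-cong (suc b) (λ j _ → ∑-*ʳ (suc A) (τ₁-pow k (b ∸ j)) (λ i → F i j)) ⟩
      ∑ (suc b) (λ j → ∑fLocal k A j * τ₁-pow k (b ∸ j))   ≡⟨ ∑-∑fLocal*τ₁-pow k A b k≥1 (ℕP.m≤n+m k a) ⟩
      1ℤ ∎

  localSum-< : ∀ k a b → 1 ≤ k → a < k → b < k → localSum k a b ≡ τ₁-pow k (a +ₙ b)
  localSum-< k a b k≥1 a<k b<k = begin
    localSum k a b
      ≡⟨ ∑-cong (suc a) (λ i i≤a → ∑-cong (suc b) (λ j j≤b → τ-factors-1 i j (ℕP.≤-pred i≤a) (ℕP.≤-pred j≤b))) ⟩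
    ∑ (suc a) (λ i → ∑ (suc b) (λ j → fLocal k i j))
      ≡⟨ ∑-comm (suc a) (suc b) (fLocal k) ⟩
    ∑fLocal k a 0 + ∑ b (λ j → ∑fLocal k a (suc j))
      ≡⟨ cong₂ _+_ (∑fLocal-zero k a) (∑-cong b (λ j j<b → ∑fLocal-suc-< k a j (ℕP.≤-trans (s≤s j<b) b<k))) ⟩
    1ℤ + ∑ b (λ j → χ (suc j +ₙ a ℕ.≟ k))
      ≡⟨ cong (1ℤ +_) (trans (∑-χ[1+i+c≡t] b a k) (χ-yes-* (a <? k) _ a<k)) ⟩
    1ℤ + χ (k ≤? b +ₙ a)
      ≡⟨ sym (τ₁-pow-<2k k (b +ₙ a) k≥1 (ℕP.+-mono-< b<k a<k)) ⟩
    τ₁-pow k (b +ₙ a)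
      ≡⟨ cong (τ₁-pow k) (ℕP.+-comm b a) ⟩
    τ₁-pow k (a +ₙ b) ∎
    where
    τ-factors-1 : ∀ i j → i ≤ a → j ≤ b → fLocal k i j * τ₁-pow k (a ∸ i) * τ₁-pow k (b ∸ j) ≡ fLocal k i j
    τ-factors-1 i j i≤a j≤b = begin
      fLocal k i j * τ₁-pow k (a ∸ i) * τ₁-pow k (b ∸ j)
        ≡⟨ cong₂ (λ x y → fLocal k i j * x * y) (τ₁-pow-< k (a ∸ i) (ℕP.≤-<-trans (ℕP.m∸n≤m a i) a<k))
                                                (τ₁-pow-< k (b ∸ j) (ℕP.≤-<-trans (ℕP.m∸n≤m b j) b<k)) ⟩
      fLocal k i j * 1ℤ * 1ℤ
        ≡⟨ trans (ℤP.*-identityʳ _) (ℤP.*-identityʳ _) ⟩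
      fLocal k i j ∎

  localSum≡τ₁-pow : ∀ k a b → 1 ≤ k → localSum k a b ≡ τ₁-pow k (a +ₙ b)
  localSum≡τ₁-pow k a b k≥1 = bounded (a +ₙ b) a b ℕP.≤-refl
    where
    peel : ∀ a b → k ≤ a → localSum k (a ∸ k) b ≡ τ₁-pow k (a ∸ k +ₙ b) → localSum k a b ≡ τ₁-pow k (a +ₙ b)
    peel a b k≤a ih = begin
      localSum k a b             ≡⟨ cong (λ t → localSum k t b) (sym (ℕP.m∸n+n≡m k≤a)) ⟩
      localSum k (a ∸ k +ₙ k) b  ≡⟨ localSum-+k k (a ∸ k) b k≥1 ⟩
      localSum k (a ∸ k) b + 1ℤ  ≡⟨ cong (_+ 1ℤ) ih ⟩
      τ₁-pow k (a ∸ k +ₙ b) + 1ℤ ≡⟨ sym (τ₁-pow-+k k (a ∸ k +ₙ b) k≥1) ⟩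
      τ₁-pow k (a ∸ k +ₙ b +ₙ k) ≡⟨ cong (τ₁-pow k) (trans (cong (_+ₙ k) (sym (ℕP.+-∸-comm b k≤a)))
                                                          (ℕP.m∸n+n≡m (ℕP.≤-trans k≤a (ℕP.m≤m+n a b)))) ⟩
      τ₁-pow k (a +ₙ b)          ∎
    smaller : ∀ {n} a b → k ≤ a → a +ₙ b ≤ suc n → a ∸ k +ₙ b ≤ n
    smaller a b k≤a le = ℕP.≤-pred (ℕP.≤-trans (ℕP.+-monoˡ-< b (ℕP.∸-monoʳ-< {a} {k} {0} k≥1 k≤a)) le)
    bounded : ∀ n a b → a +ₙ b ≤ n → localSum k a b ≡ τ₁-pow k (a +ₙ b)
    bounded n a b le with k ≤? a | k ≤? b
    ... | no k≰a | no k≰b = localSum-< k a b k≥1 (ℕP.≰⇒> k≰a) (ℕP.≰⇒> k≰b)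
    bounded (suc n) a b le | yes k≤a | _ = peel a b k≤a (bounded n (a ∸ k) b (smaller a b k≤a le))
    bounded (suc n) a b le | no _ | yes k≤b = begin
      localSum k a b    ≡⟨ localSum-comm k a b ⟩
      localSum k b a    ≡⟨ peel b a k≤b (bounded n (b ∸ k) a (smaller b a k≤b (subst (_≤ suc n) (ℕP.+-comm a b) le))) ⟩
      τ₁-pow k (b +ₙ a) ≡⟨ cong (τ₁-pow k) (ℕP.+-comm b a) ⟩
      τ₁-pow k (a +ₙ b) ∎
    bounded zero a b le | yes k≤a | _ = ⊥-elim (ℕP.<⇒≱ (ℕP.<-≤-trans k≥1 k≤a) (ℕP.≤-trans (ℕP.m≤m+n a b) le))
    bounded zero a b le | no _ | yes k≤b = ⊥-elim (ℕP.<⇒≱ (ℕP.<-≤-trans k≥1 k≤b) (ℕP.≤-trans (ℕP.m≤n+m b a) le))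


module Convolution where

  open import Data.Nat as ℕ using (ℕ; zero; suc; _^_; _∸_; _≤_; _<_; z≤n; s≤s; pred; _<?_; NonZero; >-nonZero) renaming (_*_ to _*ₙ_; _+_ to _+ₙ_)
  import Data.Nat.Properties as ℕP
  open import Data.Nat.Divisibility
  open import Data.Nat.DivMod using (_/_; m*n/n≡m; m≥n⇒m/n>0)
  open import Data.Nat.Induction using (<-rec)
  open import Data.Nat.Primality using (Prime; prime?; prime⇒nonZero; ¬prime⇒composite; composite)
  open import Data.Nat.Solver using (module +-*-Solver)
  open import Data.Integer as ℤ using (ℤ; _*_)
  open import Data.Integer.Solver using () renaming (module +-*-Solver to ℤ-Solver)
  open import Data.List using (map; upTo)
  open import Data.Product using (∃; _×_; _,_)
  open import Relation.Nullary using (yes; no; ¬_)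
  open import Relation.Binary.PropositionalEquality
  open import Data.Empty using (⊥-elim)
  open import Algebra.Properties.CommutativeSemigroup ℕP.*-commutativeSemigroup using (interchange)
  open import Defs using (ν; fk; fLocal; tau1; rhs; divIdx; sumℤ)
  open FiniteSums
  open Valuation
  open PrimePowerDivisibility
  open DivisorSums
  open PowerDivisorCount
  open FkMultiplicative
  open LocalIdentity

  open ≡-Reasoning

  -- n / d with the divisor made syntactically nonzero; it agrees with n / d whenever d ≥ 1
  _÷_ : ℕ → ℕ → ℕ
  n ÷ d = n / suc (pred d)

  *÷≡ : ∀ d q → 0 < d → (d *ₙ q) ÷ d ≡ q
  *÷≡ (suc d′) q _ = trans (cong (_/ suc d′) (ℕP.*-comm (suc d′) q)) (m*n/n≡m q (suc d′))

  ÷-∣ : ∀ {e m} → 0 < e → e ∣ m → m ÷ e ∣ m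
  ÷-∣ {e} e>0 (divides w refl) = divides e (trans (ℕP.*-comm w e) (cong (e *ₙ_) (sym w*e÷e≡w)))
    where
    w*e÷e≡w : (w *ₙ e) ÷ e ≡ w
    w*e÷e≡w = trans (cong (_÷ e) (ℕP.*-comm w e)) (*÷≡ e w e>0)

  convolution : ℕ → ℕ → ℕ → ℤ
  convolution k n₁ n₂ = ∑∣ n₁ (λ d₁ → ∑∣ n₂ (λ d₂ → fk k d₁ d₂ * τ₁ k (n₁ ÷ d₁) * τ₁ k (n₂ ÷ d₂)))

  module _ {p : ℕ} (pp : Prime p) (k : ℕ) where

    private
      instance
        p≢0 : NonZero p
        p≢0 = prime⇒nonZero pp

    p^a*m÷p^i*e : ∀ {i a e m} → i ≤ a → e ∣ m → 0 < e → (p ^ a *ₙ m) ÷ (p ^ i *ₙ e) ≡ p ^ (a ∸ i) *ₙ (m ÷ e)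
    p^a*m÷p^i*e {i} {a} {e} i≤a (divides w refl) e>0 = begin
      (p ^ a *ₙ (w *ₙ e)) ÷ (p ^ i *ₙ e)                ≡⟨ cong (λ x → (x *ₙ (w *ₙ e)) ÷ (p ^ i *ₙ e)) p^a≡ ⟩
      (p ^ i *ₙ p ^ (a ∸ i) *ₙ (w *ₙ e)) ÷ (p ^ i *ₙ e) ≡⟨ cong (_÷ (p ^ i *ₙ e)) (regroup (p ^ i) (p ^ (a ∸ i)) w e) ⟩
      (p ^ i *ₙ e *ₙ (p ^ (a ∸ i) *ₙ w)) ÷ (p ^ i *ₙ e) ≡⟨ *÷≡ (p ^ i *ₙ e) _ (ℕP.*-mono-< {0} {p ^ i} {0} (ℕP.m^n>0 p i) e>0) ⟩
      p ^ (a ∸ i) *ₙ w                                  ≡⟨ cong (p ^ (a ∸ i) *ₙ_) (sym (trans (cong (_÷ e) (ℕP.*-comm w e)) (*÷≡ e w e>0))) ⟩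
      p ^ (a ∸ i) *ₙ ((w *ₙ e) ÷ e)                     ∎
      where
      p^a≡ : p ^ a ≡ p ^ i *ₙ p ^ (a ∸ i)
      p^a≡ = trans (cong (p ^_) (sym (ℕP.m+[n∸m]≡n i≤a))) (ℕP.^-distribˡ-+-* p i (a ∸ i))
      regroup : ∀ x y z u → x *ₙ y *ₙ (z *ₙ u) ≡ x *ₙ u *ₙ (y *ₙ z)
      regroup = +-*-Solver.solve 4 (λ x y z u → x :* y :* (z :* u) := x :* u :* (y :* z)) refl
        where open +-*-Solver

    τ₁-p^a*m÷p^i*e : ∀ {i a e m} → i ≤ a → e ∣ m → ¬ (p ∣ m) →
      τ₁ k ((p ^ a *ₙ m) ÷ (p ^ i *ₙ e)) ≡ τ₁-pow k (a ∸ i) * τ₁ k (m ÷ e)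
    τ₁-p^a*m÷p^i*e {i} {a} {e} {m} i≤a e∣m p∤m = trans (cong (τ₁ k) (p^a*m÷p^i*e i≤a e∣m e>0))
                                                       (τ₁-p^c*m pp k (a ∸ i) (∤⇒∤-divisor p∤m (÷-∣ e>0 e∣m)))
      where
      e>0 : 0 < e
      e>0 = ∤⇒>0 (∤⇒∤-divisor p∤m e∣m)

    convolution-p^a*m : ∀ a b {m₁ m₂} → ¬ (p ∣ m₁) → ¬ (p ∣ m₂) →
      convolution k (p ^ a *ₙ m₁) (p ^ b *ₙ m₂) ≡ localSum k a b * convolution k m₁ m₂
    convolution-p^a*m a b {m₁} {m₂} p∤m₁ p∤m₂ = begin
      convolution k n₁ n₂
        ≡⟨ ∑∣-p^a*m pp a p∤m₁ (λ d₁ → ∑∣ n₂ (H d₁)) ⟩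
      ∑ (suc a) (λ i → ∑∣ m₁ (λ e₁ → ∑∣ n₂ (H (p ^ i *ₙ e₁))))
        ≡⟨ ∑-cong (suc a) (λ i _ → ∑∣-cong m₁ (λ e₁ _ → ∑∣-p^a*m pp b p∤m₂ (H (p ^ i *ₙ e₁)))) ⟩
      ∑ (suc a) (λ i → ∑∣ m₁ (λ e₁ → ∑ (suc b) (λ j → ∑∣ m₂ (λ e₂ → H (p ^ i *ₙ e₁) (p ^ j *ₙ e₂)))))
        ≡⟨ ∑-cong (suc a) (λ i i≤a → ∑∣-cong m₁ (λ e₁ e₁∣m₁ → ∑-cong (suc b) (λ j j≤b → ∑∣-cong m₂ (λ e₂ e₂∣m₂ →
             term-split (ℕP.≤-pred i≤a) (ℕP.≤-pred j≤b) e₁∣m₁ e₂∣m₂)))) ⟩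
      ∑ (suc a) (λ i → ∑∣ m₁ (λ e₁ → ∑ (suc b) (λ j → ∑∣ m₂ (λ e₂ → c i j * X e₁ e₂))))
        ≡⟨ ∑-cong (suc a) (λ i _ → ∑∣-cong m₁ (λ e₁ _ → trans (∑-cong (suc b) (λ j _ → ∑∣-*ˡ m₂ (c i j) (X e₁)))
                                                               (∑-*ʳ (suc b) (∑∣ m₂ (X e₁)) (c i)))) ⟩
      ∑ (suc a) (λ i → ∑∣ m₁ (λ e₁ → ∑ (suc b) (c i) * ∑∣ m₂ (X e₁)))
        ≡⟨ ∑-cong (suc a) (λ i _ → ∑∣-*ˡ m₁ (∑ (suc b) (c i)) (λ e₁ → ∑∣ m₂ (X e₁))) ⟩
      ∑ (suc a) (λ i → ∑ (suc b) (c i) * convolution k m₁ m₂)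
        ≡⟨ ∑-*ʳ (suc a) (convolution k m₁ m₂) (λ i → ∑ (suc b) (c i)) ⟩
      localSum k a b * convolution k m₁ m₂ ∎
      where
      n₁ = p ^ a *ₙ m₁
      n₂ = p ^ b *ₙ m₂
      H : ℕ → ℕ → ℤ
      H d₁ d₂ = fk k d₁ d₂ * τ₁ k (n₁ ÷ d₁) * τ₁ k (n₂ ÷ d₂)
      c : ℕ → ℕ → ℤ
      c i j = fLocal k i j * τ₁-pow k (a ∸ i) * τ₁-pow k (b ∸ j)
      X : ℕ → ℕ → ℤ
      X e₁ e₂ = fk k e₁ e₂ * τ₁ k (m₁ ÷ e₁) * τ₁ k (m₂ ÷ e₂)
      term-split : ∀ {i j e₁ e₂} → i ≤ a → j ≤ b → e₁ ∣ m₁ → e₂ ∣ m₂ → H (p ^ i *ₙ e₁) (p ^ j *ₙ e₂) ≡ c i j * X e₁ e₂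
      term-split {i} {j} {e₁} {e₂} i≤a j≤b e₁∣m₁ e₂∣m₂ = begin
        H (p ^ i *ₙ e₁) (p ^ j *ₙ e₂)
          ≡⟨ cong₂ _*_ (cong₂ _*_ (fk-p^i*e pp k (∤⇒∤-divisor p∤m₁ e₁∣m₁) (∤⇒∤-divisor p∤m₂ e₂∣m₂) i j)
                                  (τ₁-p^a*m÷p^i*e i≤a e₁∣m₁ p∤m₁))
                       (τ₁-p^a*m÷p^i*e j≤b e₂∣m₂ p∤m₂) ⟩
        fLocal k i j * fk k e₁ e₂ * (τ₁-pow k (a ∸ i) * τ₁ k (m₁ ÷ e₁)) * (τ₁-pow k (b ∸ j) * τ₁ k (m₂ ÷ e₂))
          ≡⟨ ℤ-Solver.solve 6 (λ f g t u v w → f :* g :* (t :* u) :* (v :* w) := f :* t :* v :* (g :* u :* w)) refl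
               (fLocal k i j) (fk k e₁ e₂) (τ₁-pow k (a ∸ i)) (τ₁ k (m₁ ÷ e₁)) (τ₁-pow k (b ∸ j)) (τ₁ k (m₂ ÷ e₂)) ⟩
        c i j * X e₁ e₂ ∎
        where open ℤ-Solver using (_:*_; _:=_)

  prime-divisor : ∀ n → 1 < n → ∃ λ p → Prime p × p ∣ n
  prime-divisor = <-rec (λ n → 1 < n → ∃ λ p → Prime p × p ∣ n) go
    where
    go : ∀ n → (∀ {m} → m < n → 1 < m → ∃ λ p → Prime p × p ∣ m) → 1 < n → ∃ λ p → Prime p × p ∣ n
    go 1             _   (s≤s ())
    go (suc (suc m)) rec _ with prime? (suc (suc m))
    ... | yes n-prime = suc (suc m) , n-prime , ∣-refl
    ... | no ¬n-prime with ¬prime⇒composite ¬n-prime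
    ...   | composite {d} d<n d∣n with rec d<n (ℕ.nonTrivial⇒n>1 d)
    ...     | p , pp , p∣d = p , pp , ∣-trans p∣d d∣n

  record PrimeSplitting (n₁ n₂ : ℕ) : Set where
    field
      p a b m₁ m₂ : ℕ
      p-prime     : Prime p
      n₁≡         : n₁ ≡ p ^ a *ₙ m₁
      n₂≡         : n₂ ≡ p ^ b *ₙ m₂
      p∤m₁        : ¬ (p ∣ m₁)
      p∤m₂        : ¬ (p ∣ m₂)
      m₁m₂<n₁n₂   : m₁ *ₙ m₂ < n₁ *ₙ n₂

  prime-splitting : ∀ {n₁ n₂} → 0 < n₁ → 0 < n₂ → 1 < n₁ *ₙ n₂ → PrimeSplitting n₁ n₂
  prime-splitting {n₁} {n₂} n₁>0 n₂>0 1<n₁n₂ with prime-divisor (n₁ *ₙ n₂) 1<n₁n₂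
  ... | p , pp , p∣n₁n₂ with p-free-part pp n₁ n₁>0 | p-free-part pp n₂ n₂>0
  ...   | m₁ , n₁≡ , p∤m₁ | m₂ , n₂≡ , p∤m₂ = record
    { p = p ; a = ν p n₁ ; b = ν p n₂ ; m₁ = m₁ ; m₂ = m₂ ; p-prime = pp
    ; n₁≡ = n₁≡ ; n₂≡ = n₂≡ ; p∤m₁ = p∤m₁ ; p∤m₂ = p∤m₂
    ; m₁m₂<n₁n₂ = ℕP.≤∧≢⇒< (∣⇒≤ {{>-nonZero (ℕP.<-trans (s≤s z≤n) 1<n₁n₂)}} m₁m₂∣n₁n₂)
                           (λ m₁m₂≡n₁n₂ → ∤-*-prime pp p∤m₁ p∤m₂ (subst (p ∣_) (sym m₁m₂≡n₁n₂) p∣n₁n₂))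
    }
    where
    m∣p^v*m : ∀ {n m} v → n ≡ p ^ v *ₙ m → m ∣ n
    m∣p^v*m v refl = n∣m*n (p ^ v)
    m₁m₂∣n₁n₂ : m₁ *ₙ m₂ ∣ n₁ *ₙ n₂
    m₁m₂∣n₁n₂ = *-pres-∣ (m∣p^v*m (ν p n₁) n₁≡) (m∣p^v*m (ν p n₂) n₂≡)

  *≯1⇒≡1 : ∀ {x y} → 0 < x → 0 < y → ¬ (1 < x *ₙ y) → x ≡ 1 × y ≡ 1
  *≯1⇒≡1 {x} {y} x>0 y>0 1≮xy = ℕP.m*n≡1⇒m≡1 x y xy≡1 , ℕP.m*n≡1⇒n≡1 x y xy≡1
    where
    xy≡1 : x *ₙ y ≡ 1
    xy≡1 = ℕP.≤-antisym (ℕP.≮⇒≥ 1≮xy) (ℕP.*-mono-< {0} {x} {0} x>0 y>0)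

  τ₁-1≡convolution-1-1 : ∀ {k} → τ₁ k 1 ≡ convolution k 1 1
  τ₁-1≡convolution-1-1 {k} rewrite τ₁-1 k = refl

  τ₁-*≡convolution : ∀ k → 1 ≤ k → ∀ {n₁ n₂} → 0 < n₁ → 0 < n₂ → τ₁ k (n₁ *ₙ n₂) ≡ convolution k n₁ n₂
  τ₁-*≡convolution k k≥1 n₁>0 n₂>0 = <-rec P step _ refl n₁>0 n₂>0
    where
    P : ℕ → Set
    P N = ∀ {n₁ n₂} → n₁ *ₙ n₂ ≡ N → 0 < n₁ → 0 < n₂ → τ₁ k (n₁ *ₙ n₂) ≡ convolution k n₁ n₂
    step : ∀ N → (∀ {M} → M < N → P M) → P N
    step N rec {n₁} {n₂} refl n₁>0 n₂>0 with 1 <? n₁ *ₙ n₂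
    ... | yes 1<n₁n₂ = begin
      τ₁ k (n₁ *ₙ n₂)
        ≡⟨ cong (τ₁ k) n₁n₂≡ ⟩
      τ₁ k (p ^ (a +ₙ b) *ₙ (m₁ *ₙ m₂))
        ≡⟨ τ₁-p^c*m p-prime k (a +ₙ b) (∤-*-prime p-prime p∤m₁ p∤m₂) ⟩
      τ₁-pow k (a +ₙ b) * τ₁ k (m₁ *ₙ m₂)
        ≡⟨ cong₂ _*_ (sym (localSum≡τ₁-pow k a b k≥1)) (rec m₁m₂<n₁n₂ refl (∤⇒>0 p∤m₁) (∤⇒>0 p∤m₂)) ⟩
      localSum k a b * convolution k m₁ m₂
        ≡⟨ sym (convolution-p^a*m p-prime k a b p∤m₁ p∤m₂) ⟩
      convolution k (p ^ a *ₙ m₁) (p ^ b *ₙ m₂)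
        ≡⟨ cong₂ (convolution k) (sym n₁≡) (sym n₂≡) ⟩
      convolution k n₁ n₂ ∎
      where
      open PrimeSplitting (prime-splitting n₁>0 n₂>0 1<n₁n₂)
      n₁n₂≡ : n₁ *ₙ n₂ ≡ p ^ (a +ₙ b) *ₙ (m₁ *ₙ m₂)
      n₁n₂≡ = trans (cong₂ _*ₙ_ n₁≡ n₂≡) (trans (interchange (p ^ a) m₁ (p ^ b) m₂)
                                                 (cong (_*ₙ (m₁ *ₙ m₂)) (sym (ℕP.^-distribˡ-+-* p a b))))
    ... | no 1≮n₁n₂ with *≯1⇒≡1 n₁>0 n₂>0 1≮n₁n₂
    ...   | refl , refl = τ₁-1≡convolution-1-1 {k}

  sumℤ-divIdx : ∀ n (g : ℕ → ℤ) → sumℤ (map g (divIdx n)) ≡ ∑∣ n (λ d → g (pred d))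
  sumℤ-divIdx n g = trans (sumℤ-map-filter (λ i → suc i ∣? n) g (upTo n)) (sumℤ-map-upTo n (λ i → χ (suc i ∣? n) * g i))

  rhs≡convolution : ∀ k {n₁ n₂} → 1 ≤ k → 0 < n₁ → 0 < n₂ → rhs k n₁ n₂ ≡ convolution k n₁ n₂
  rhs≡convolution k {n₁} {n₂} k≥1 n₁>0 n₂>0 = begin
    rhs k n₁ n₂
      ≡⟨ sumℤ-concatMap (λ i → map (term i) (divIdx n₂)) (divIdx n₁) ⟩
    sumℤ (map (λ i → sumℤ (map (term i) (divIdx n₂))) (divIdx n₁))
      ≡⟨ sumℤ-divIdx n₁ (λ i → sumℤ (map (term i) (divIdx n₂))) ⟩
    ∑∣ n₁ (λ d₁ → sumℤ (map (term (pred d₁)) (divIdx n₂)))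
      ≡⟨ ∑∣-cong n₁ (λ d₁ _ → sumℤ-divIdx n₂ (term (pred d₁))) ⟩
    ∑∣ n₁ (λ d₁ → ∑∣ n₂ (λ d₂ → term (pred d₁) (pred d₂)))
      ≡⟨ ∑∣-cong n₁ (λ d₁ d₁∣n₁ → ∑∣-cong n₂ (λ d₂ d₂∣n₂ → tau1≡τ₁-in-term d₁∣n₁ d₂∣n₂)) ⟩
    convolution k n₁ n₂ ∎
    where
    term : ℕ → ℕ → ℤ
    term i j = fk k (suc i) (suc j) * ℤ.+ tau1 k (n₁ / suc i) * ℤ.+ tau1 k (n₂ / suc j)
    quotient>0 : ∀ {d n} → 0 < n → suc d ∣ n → 0 < n / suc d
    quotient>0 n>0 d∣n = m≥n⇒m/n>0 (∣⇒≤ {{>-nonZero n>0}} d∣n)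
    tau1≡τ₁-in-term : ∀ {d₁ d₂} → d₁ ∣ n₁ → d₂ ∣ n₂ →
      term (pred d₁) (pred d₂) ≡ fk k d₁ d₂ * τ₁ k (n₁ ÷ d₁) * τ₁ k (n₂ ÷ d₂)
    tau1≡τ₁-in-term {suc d₁} {suc d₂} d₁∣n₁ d₂∣n₂ =
      cong₂ _*_ (cong (fk k (suc d₁) (suc d₂) *_) (tau1≡τ₁ k (n₁ / suc d₁) k≥1 (quotient>0 n₁>0 d₁∣n₁)))
                (tau1≡τ₁ k (n₂ / suc d₂) k≥1 (quotient>0 n₂>0 d₂∣n₂))
    tau1≡τ₁-in-term {zero}          0∣n₁ _    = ⊥-elim (ℕP.<⇒≢ n₁>0 (sym (0∣⇒≡0 0∣n₁)))
    tau1≡τ₁-in-term {suc _} {zero}  _    0∣n₂ = ⊥-elim (ℕP.<⇒≢ n₂>0 (sym (0∣⇒≡0 0∣n₂)))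


open import Defs
open import Data.Nat using (ℕ; _≤_; _*_)
open import Data.Nat.Properties using (*-mono-<)
open import Data.Integer using (+_)
open import Relation.Binary.PropositionalEquality using (_≡_; sym; module ≡-Reasoning)
open ≡-Reasoning
open PowerDivisorCount using (τ₁; tau1≡τ₁)
open Convolution using (convolution; τ₁-*≡convolution; rhs≡convolution)

corollary1 : (k : ℕ) → 1 ≤ k → (n₁ n₂ : ℕ) → 1 ≤ n₁ → 1 ≤ n₂ →
    + tau1 k (n₁ * n₂) ≡ rhs k n₁ n₂
corollary1 k k≥1 n₁ n₂ n₁>0 n₂>0 = begin
  + tau1 k (n₁ * n₂)  ≡⟨ tau1≡τ₁ k (n₁ * n₂) k≥1 (*-mono-< {0} {n₁} {0} n₁>0 n₂>0) ⟩
  τ₁ k (n₁ * n₂)      ≡⟨ τ₁-*≡convolution k k≥1 n₁>0 n₂>0 ⟩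
  convolution k n₁ n₂ ≡⟨ sym (rhs≡convolution k k≥1 n₁>0 n₂>0) ⟩
  rhs k n₁ n₂         ∎
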